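{- For integers $n \ge 1$ and $k \ge 1$, let $f(n,k)$ be the number of $k$-tuples $(x_1,\dots,x_k)$ of elements of $\mathbb{F}_3^n$ such that $x_i \neq x_j$ for all $i \neq j$ and $x_i + x_j + x_\ell \neq 0$ for all pairwise distinct indices $i,j,\ell$. Let $q = 3^n$. Then: (A) For each fixed $k$, $f(n,k)$ is a polynomial of degree $k$ in $q$ with integer coefficients of alternating sign; that is, there are non-negative integers $c_1(k),\dots,c_k(k)$, independent of $n$, such that for all $n \ge 1$, $$f(n,k) = q^k - c_1(k)q^{k-1} + c_2(k)q^{k-2} - \cdots + (-1)^k c_k(k).$$ (B) As $k$ varies, for each fixed $i$ the coefficient $c_i(k)$ is a polynomial in $k$ of degree at most $3i$.
   Context: $f(n,k)$ counts ordered "SET-free" $k$-element subsets of $\mathbb{F}_3^n$: sets of $k$ distinct vectors containing no three distinct vectors $\vec x,\vec y,\vec z$ with $\vec x+\vec y+\vec z=0$, counted with an ordering. The coefficient $c_i(k)$ is the absolute value of the coefficient of $q^{k-i}$ in the polynomial of part (A) (with $c_0(k)=1$, and $c_i(k)=0$ for $i>k$). -}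

module Defs where

open import Data.Nat as ℕ using (ℕ; zero; suc; _%_; _∸_; _≤_)
open import Data.Nat.DivMod using (m%n<n)
open import Data.Fin as Fin using (Fin; fromℕ<; toℕ)
open import Data.Fin.Properties using (all?) renaming (_≟_ to _≟ᶠ_)
open import Data.Vec as Vec using (Vec; []; _∷_; lookup; zipWith; replicate)
open import Data.Vec.Properties using (≡-dec)
open import Data.List as List using (List; [_]; concatMap; map; filter; length; allFin)
open import Data.Integer as ℤ using (ℤ; +_; -[1+_])
open import Data.Rational as ℚ using (ℚ)
open import Relation.Binary.PropositionalEquality using (_≡_; _≢_)
open import Relation.Nullary using (Dec; ¬?)
open import Relation.Nullary.Decidable using (_→-dec_; _×-dec_)
open import Data.Product using (_×_)

_⊕_ : Fin 3 → Fin 3 → Fin 3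
a ⊕ b = fromℕ< (m%n<n (toℕ a ℕ.+ toℕ b) 3)

F3^ : ℕ → Set
F3^ n = Vec (Fin 3) n

_+v_ : ∀ {n} → F3^ n → F3^ n → F3^ n
_+v_ = zipWith _⊕_

0v : ∀ {n} → F3^ n
0v = replicate _ Fin.zero

Distinct : ∀ {n k} → Vec (F3^ n) k → Set
Distinct xs = ∀ i j → i ≢ j → lookup xs i ≢ lookup xs j

NoSet : ∀ {n k} → Vec (F3^ n) k → Set
NoSet xs = ∀ i j l → i ≢ j → j ≢ l → i ≢ l →
  ((lookup xs i +v lookup xs j) +v lookup xs l) ≢ 0v

SetFreeTuple : ∀ {n k} → Vec (F3^ n) k → Set
SetFreeTuple xs = Distinct xs × NoSet xs

private
  _≟v_ : ∀ {n} (x y : F3^ n) → Dec (x ≡ y)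
  _≟v_ = ≡-dec _≟ᶠ_

setFreeTuple? : ∀ {n k} (xs : Vec (F3^ n) k) → Dec (SetFreeTuple xs)
setFreeTuple? xs =
  (all? λ i → all? λ j → ¬? (i ≟ᶠ j) →-dec ¬? (lookup xs i ≟v lookup xs j))
  ×-dec
  (all? λ i → all? λ j → all? λ l →
     ¬? (i ≟ᶠ j) →-dec ¬? (j ≟ᶠ l) →-dec ¬? (i ≟ᶠ l) →-dec
     ¬? (((lookup xs i +v lookup xs j) +v lookup xs l) ≟v 0v))

allVecs : (n : ℕ) → List (F3^ n)
allVecs zero = [ [] ]
allVecs (suc n) = concatMap (λ a → map (a ∷_) (allVecs n)) (allFin 3)

allTuples : ∀ {A : Set} → List A → (k : ℕ) → List (Vec A k)
allTuples xs zero = [ [] ]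
allTuples xs (suc k) = concatMap (λ a → map (a ∷_) (allTuples xs k)) xs

f : ℕ → ℕ → ℕ
f n k = length (filter setFreeTuple? (allTuples (allVecs n) k))

sumℤ : ℕ → (ℕ → ℤ) → ℤ
sumℤ zero g = g 0
sumℤ (suc m) g = sumℤ m g ℤ.+ g (suc m)

altPoly : (k : ℕ) → (ℕ → ℕ) → ℤ → ℤ
altPoly k c q = sumℤ k (λ i → (-[1+ 0 ] ℤ.^ i) ℤ.* (+ c i) ℤ.* (q ℤ.^ (k ∸ i)))

evalPoly : ∀ {m} → Vec ℚ m → ℚ → ℚ
evalPoly [] x = ℚ.0ℚ
evalPoly (a ∷ as) x = a ℚ.+ x ℚ.* evalPoly as x

ℕtoℚ : ℕ → ℚ
ℕtoℚ m = (+ m) ℚ./ 1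

-- A tuple is SET-free exactly when it avoids the hyperplanes x_i = x_j and x_i + x_j + x_l = 0
-- of (𝔽₃ⁿ)ᵏ.  For any arrangement of linear forms over 𝔽₃, deletion–restriction (the points off
-- ℓ and the rest are those off the rest, minus those on the hyperplane ℓ = 0, itself an
-- arrangement in one variable less) shows that the number of points avoiding it is
-- Σᵢ (−1)ⁱ cᵢ q^(k−i) with q = 3ⁿ and natural numbers cᵢ independent of n.  Whitney's formula
-- writes cᵢ as a signed count of the sub-arrangements of rank i.  Counting only those that use
-- the first j variables gives a table with Pascal's rule in (j, k), whose entries vanish for
-- j > 3i, because forms in at most three variables can only involve 3i variables at rank i.
-- Newton's forward difference formula then gives cᵢ(k) = Σ_{t ≤ 3i} (k choose t) aₜ, a
-- polynomial in k of degree at most 3i.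

module Submission where

open import Data.Bool using (if_then_else_)
open import Data.Empty using (⊥-elim)
open import Data.Fin as Fin using (Fin; toℕ; punchIn; punchOut)
open import Data.Fin.Properties as Fin using (all?)
open import Data.Integer as ℤ using (ℤ; +_; -[1+_]; _+_; _*_; -_; _-_; _^_)
import Data.Integer.Properties as ℤ
open import Data.Integer.Tactic.RingSolver using (solve-∀)
open import Data.List as List using (List; []; _∷_; _++_; map; concatMap; filter; length)
import Data.List.Properties as List
open import Data.List.Relation.Unary.All as All using (All; []; _∷_)
import Data.List.Relation.Unary.All.Properties as Allₚ
open import Data.List.Relation.Unary.Any as Any using (Any; here; there)
open import Data.Nat as ℕ using (ℕ; zero; suc; _≤_; _<_; z≤n; s≤s; _∸_; _!)
open import Data.Nat.Combinatorics using (_C_; nCk+nC[k+1]≡[n+1]C[k+1])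
open import Data.Nat.ListAction using (sum)
open import Data.Nat.ListAction.Properties using (sum-++)
import Data.Nat.Properties as ℕ
import Data.Nat.Tactic.RingSolver as ℕ
open import Data.Product using (Σ; ∃; _×_; _,_; proj₁; proj₂)
open import Data.Rational as ℚ using (ℚ)
import Data.Rational.Properties as ℚ
import Data.Rational.Unnormalised as ℚᵘ
import Data.Rational.Unnormalised.Properties as ℚᵘ
open import Data.Sum using (_⊎_; inj₁; inj₂; [_,_])
open import Data.Sum.Function.Propositional using (_⊎-⇔_)
open import Data.Unit using (⊤; tt)
open import Data.Vec as Vec using (Vec; []; _∷_; lookup; replicate; zipWith; tabulate; insertAt; removeAt)
import Data.Vec.Properties as Vec
open import Function using (_⇔_; mk⇔; Equivalence; _∘_; id)
open import Relation.Binary.PropositionalEquality hiding ([_])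
open import Relation.Nullary using (Dec; yes; no; ¬_; ¬?; _×-dec_; _→-dec_; _⊎-dec_)
open import Relation.Nullary.Decidable using (toWitness; does; dec-true; dec-false)

open import Defs

𝔽 : Set
𝔽 = Fin 3

pattern 0F = Fin.zero
pattern 1F = Fin.suc Fin.zero
pattern 2F = Fin.suc (Fin.suc Fin.zero)

infix 4 _≟_
_≟_ : ∀ {n} (x y : F3^ n) → Dec (x ≡ y)
_≟_ = Vec.≡-dec Fin._≟_

infix 35 ⊖_
⊖_ : 𝔽 → 𝔽
⊖ 0F = 0F
⊖ 1F = 2F
⊖ 2F = 1F

infixl 30 _⊗_
_⊗_ : 𝔽 → 𝔽 → 𝔽
0F ⊗ b = 0F
1F ⊗ b = b
2F ⊗ b = ⊖ b

⊕-comm : ∀ a b → a ⊕ b ≡ b ⊕ a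
⊕-comm = toWitness {a? = all? λ a → all? λ b → a ⊕ b Fin.≟ b ⊕ a} _

⊕-assoc : ∀ a b c → (a ⊕ b) ⊕ c ≡ a ⊕ (b ⊕ c)
⊕-assoc = toWitness {a? = all? λ a → all? λ b → all? λ c → (a ⊕ b) ⊕ c Fin.≟ a ⊕ (b ⊕ c)} _

⊕-identityˡ : ∀ a → 0F ⊕ a ≡ a
⊕-identityˡ = toWitness {a? = all? λ a → 0F ⊕ a Fin.≟ a} _

⊕-identityʳ : ∀ a → a ⊕ 0F ≡ a
⊕-identityʳ = toWitness {a? = all? λ a → a ⊕ 0F Fin.≟ a} _

⊗-zeroʳ : ∀ a → a ⊗ 0F ≡ 0F
⊗-zeroʳ = toWitness {a? = all? λ a → a ⊗ 0F Fin.≟ 0F} _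

⊗-assoc : ∀ a b c → a ⊗ b ⊗ c ≡ a ⊗ (b ⊗ c)
⊗-assoc = toWitness {a? = all? λ a → all? λ b → all? λ c → a ⊗ b ⊗ c Fin.≟ a ⊗ (b ⊗ c)} _

⊗-distribˡ-⊕ : ∀ a b c → a ⊗ (b ⊕ c) ≡ a ⊗ b ⊕ a ⊗ c
⊗-distribˡ-⊕ = toWitness {a? = all? λ a → all? λ b → all? λ c → a ⊗ (b ⊕ c) Fin.≟ a ⊗ b ⊕ a ⊗ c} _

⊗-distribʳ-⊕ : ∀ a b c → (b ⊕ c) ⊗ a ≡ b ⊗ a ⊕ c ⊗ a
⊗-distribʳ-⊕ = toWitness {a? = all? λ a → all? λ b → all? λ c → (b ⊕ c) ⊗ a Fin.≟ b ⊗ a ⊕ c ⊗ a} _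

a⊗x⊕e≡0⇒x≡⊖a⊗e : ∀ a x e → a ≢ 0F → a ⊗ x ⊕ e ≡ 0F → x ≡ ⊖ a ⊗ e
a⊗x⊕e≡0⇒x≡⊖a⊗e = toWitness {a? = all? λ a → all? λ x → all? λ e →
  ¬? (a Fin.≟ 0F) →-dec a ⊗ x ⊕ e Fin.≟ 0F →-dec x Fin.≟ ⊖ a ⊗ e} _

a⊗[⊖a⊗e]⊕e≡0 : ∀ a e → a ≢ 0F → a ⊗ (⊖ a ⊗ e) ⊕ e ≡ 0F
a⊗[⊖a⊗e]⊕e≡0 = toWitness {a? = all? λ a → all? λ e → ¬? (a Fin.≟ 0F) →-dec a ⊗ (⊖ a ⊗ e) ⊕ e Fin.≟ 0F} _

infixr 30 _·_
_·_ : ∀ {n} → 𝔽 → F3^ n → F3^ n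
a · x = Vec.map (a ⊗_) x

+v-comm : ∀ {n} (x y : F3^ n) → x +v y ≡ y +v x
+v-comm = Vec.zipWith-comm ⊕-comm

+v-assoc : ∀ {n} (x y z : F3^ n) → (x +v y) +v z ≡ x +v (y +v z)
+v-assoc = Vec.zipWith-assoc ⊕-assoc

+v-identityˡ : ∀ {n} (x : F3^ n) → 0v +v x ≡ x
+v-identityˡ = Vec.zipWith-identityˡ ⊕-identityˡ

+v-identityʳ : ∀ {n} (x : F3^ n) → x +v 0v ≡ x
+v-identityʳ = Vec.zipWith-identityʳ ⊕-identityʳ

+v-interchange : ∀ {n} (a b c d : F3^ n) → (a +v b) +v (c +v d) ≡ (a +v c) +v (b +v d)
+v-interchange a b c d = begin
  (a +v b) +v (c +v d)  ≡⟨ +v-assoc a b (c +v d) ⟩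
  a +v (b +v (c +v d))  ≡⟨ cong (a +v_) (sym (+v-assoc b c d)) ⟩
  a +v ((b +v c) +v d)  ≡⟨ cong (λ z → a +v (z +v d)) (+v-comm b c) ⟩
  a +v ((c +v b) +v d)  ≡⟨ cong (a +v_) (+v-assoc c b d) ⟩
  a +v (c +v (b +v d))  ≡⟨ sym (+v-assoc a c (b +v d)) ⟩
  (a +v c) +v (b +v d)  ∎
  where open ≡-Reasoning

·-zeroˡ : ∀ {n} (x : F3^ n) → 0F · x ≡ 0v
·-zeroˡ x = Vec.map-const x 0F

·-zeroʳ : ∀ {n} a → a · 0v {n} ≡ 0v
·-zeroʳ {n} a = trans (Vec.map-replicate (a ⊗_) 0F n) (cong (replicate n) (⊗-zeroʳ a))

·-identityˡ : ∀ {n} (x : F3^ n) → 1F · x ≡ x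
·-identityˡ = Vec.map-id

·-assoc : ∀ {n} a b (x : F3^ n) → a · b · x ≡ (a ⊗ b) · x
·-assoc a b x = trans (sym (Vec.map-∘ (a ⊗_) (b ⊗_) x)) (Vec.map-cong (λ c → sym (⊗-assoc a b c)) x)

·-distribˡ-+v : ∀ {n} a (x y : F3^ n) → a · (x +v y) ≡ a · x +v a · y
·-distribˡ-+v a [] [] = refl
·-distribˡ-+v a (b ∷ x) (c ∷ y) = cong₂ _∷_ (⊗-distribˡ-⊕ a b c) (·-distribˡ-+v a x y)

·-distribʳ-⊕ : ∀ {n} a b (x : F3^ n) → (a ⊕ b) · x ≡ a · x +v b · x
·-distribʳ-⊕ a b [] = refl
·-distribʳ-⊕ a b (c ∷ x) = cong₂ _∷_ (⊗-distribʳ-⊕ c a b) (·-distribʳ-⊕ a b x)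

a·x+e≡0⇔x≡⊖a·e : ∀ {n} a (x e : F3^ n) → a ≢ 0F → (a · x +v e ≡ 0v) ⇔ (x ≡ ⊖ a · e)
a·x+e≡0⇔x≡⊖a·e a x e a≢0 = mk⇔ (unique x e) (λ { refl → exists e })
  where
  unique : ∀ {n} (x e : F3^ n) → a · x +v e ≡ 0v → x ≡ ⊖ a · e
  unique [] [] _ = refl
  unique (b ∷ x) (c ∷ e) eq =
    cong₂ _∷_ (a⊗x⊕e≡0⇒x≡⊖a⊗e a b c a≢0 (cong Vec.head eq)) (unique x e (cong Vec.tail eq))
  exists : ∀ {n} (e : F3^ n) → a · (⊖ a · e) +v e ≡ 0v
  exists [] = refl
  exists (c ∷ e) = cong₂ _∷_ (a⊗[⊖a⊗e]⊕e≡0 a c a≢0) (exists e)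

Form : ℕ → Set
Form k = Vec 𝔽 k

eval : ∀ {n k} → Form k → Vec (F3^ n) k → F3^ n
eval [] [] = 0v
eval (a ∷ ℓ) (x ∷ xs) = a · x +v eval ℓ xs

zeroForm : ∀ {k} → Form k
zeroForm = tabulate (λ _ → 0F)

eval-tabulate-zero : ∀ {n k} (g : Fin k → 𝔽) (xs : Vec (F3^ n) k) → (∀ t → g t ≡ 0F) → eval (tabulate g) xs ≡ 0v
eval-tabulate-zero g [] _ = refl
eval-tabulate-zero g (x ∷ xs) g≗0 =
  trans (cong₂ _+v_ (trans (cong (_· x) (g≗0 Fin.zero)) (·-zeroˡ x)) (eval-tabulate-zero _ xs (λ t → g≗0 (Fin.suc t))))
        (+v-identityʳ 0v)

eval-zeroForm : ∀ {n k} (xs : Vec (F3^ n) k) → eval zeroForm xs ≡ 0v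
eval-zeroForm xs = eval-tabulate-zero _ xs (λ _ → refl)

scaleAdd : ∀ {k} → 𝔽 → Form k → Form k → Form k
scaleAdd α = zipWith (λ u v → α ⊗ u ⊕ v)

eval-scaleAdd : ∀ {n k} α (ℓ m : Form k) (xs : Vec (F3^ n) k) →
  eval (scaleAdd α ℓ m) xs ≡ α · eval ℓ xs +v eval m xs
eval-scaleAdd α [] [] [] = sym (trans (cong (_+v 0v) (·-zeroʳ α)) (+v-identityʳ 0v))
eval-scaleAdd α (u ∷ ℓ) (v ∷ m) (x ∷ xs) = begin
  (α ⊗ u ⊕ v) · x +v eval (scaleAdd α ℓ m) xs
    ≡⟨ cong₂ _+v_ (·-distribʳ-⊕ (α ⊗ u) v x) (eval-scaleAdd α ℓ m xs) ⟩
  ((α ⊗ u) · x +v v · x) +v (α · eval ℓ xs +v eval m xs)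
    ≡⟨ cong (λ z → (z +v v · x) +v (α · eval ℓ xs +v eval m xs)) (sym (·-assoc α u x)) ⟩
  (α · u · x +v v · x) +v (α · eval ℓ xs +v eval m xs)
    ≡⟨ +v-interchange (α · u · x) (v · x) (α · eval ℓ xs) (eval m xs) ⟩
  (α · u · x +v α · eval ℓ xs) +v (v · x +v eval m xs)
    ≡⟨ cong (_+v (v · x +v eval m xs)) (sym (·-distribˡ-+v α (u · x) (eval ℓ xs))) ⟩
  α · (u · x +v eval ℓ xs) +v (v · x +v eval m xs)
    ∎
  where open ≡-Reasoning

eval-insertAt : ∀ {n k} (ℓ : Form k) (r : Fin (suc k)) c (xs : Vec (F3^ n) k) x →
  eval (insertAt ℓ r c) (insertAt xs r x) ≡ c · x +v eval ℓ xs
eval-insertAt ℓ Fin.zero c xs x = refl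
eval-insertAt (b ∷ ℓ) (Fin.suc r) c (y ∷ xs) x = begin
  b · y +v eval (insertAt ℓ r c) (insertAt xs r x)  ≡⟨ cong (b · y +v_) (eval-insertAt ℓ r c xs x) ⟩
  b · y +v (c · x +v eval ℓ xs)                     ≡⟨ sym (+v-assoc (b · y) (c · x) (eval ℓ xs)) ⟩
  (b · y +v c · x) +v eval ℓ xs                     ≡⟨ cong (_+v eval ℓ xs) (+v-comm (b · y) (c · x)) ⟩
  (c · x +v b · y) +v eval ℓ xs                     ≡⟨ +v-assoc (c · x) (b · y) (eval ℓ xs) ⟩
  c · x +v (b · y +v eval ℓ xs)                     ∎
  where open ≡-Reasoning

-- Solving for the variable of the first nonzero coefficient identifies the points on the
-- hyperplane ℓ = 0 with all points in one variable less.
data Pivot : ∀ {k} → Form (suc k) → Set where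
  here  : ∀ {k a} {ℓ : Form k} → a ≢ 0F → Pivot (a ∷ ℓ)
  there : ∀ {k} {ℓ : Form (suc k)} → Pivot ℓ → Pivot (0F ∷ ℓ)

pivot? : ∀ {k} (ℓ : Form (suc k)) → Pivot ℓ ⊎ ℓ ≡ zeroForm
pivot? (1F ∷ ℓ) = inj₁ (here λ ())
pivot? (2F ∷ ℓ) = inj₁ (here λ ())
pivot? {zero} (0F ∷ []) = inj₂ refl
pivot? {suc k} (0F ∷ ℓ) with pivot? ℓ
... | inj₁ p = inj₁ (there p)
... | inj₂ ℓ≡0 = inj₂ (cong (0F ∷_) ℓ≡0)

Pivot⇒≢zeroForm : ∀ {k} {ℓ : Form (suc k)} → Pivot ℓ → ℓ ≢ zeroForm
Pivot⇒≢zeroForm (here a≢0) eq = a≢0 (cong Vec.head eq)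
Pivot⇒≢zeroForm {suc k} (there p) eq = Pivot⇒≢zeroForm p (cong Vec.tail eq)

solveFor : ∀ {n k} {ℓ : Form (suc k)} → Pivot ℓ → Vec (F3^ n) k → Vec (F3^ n) (suc k)
solveFor (here {a = a} {ℓ = ℓ} _) xs = ⊖ a · eval ℓ xs ∷ xs
solveFor (there p) (x ∷ xs) = x ∷ solveFor p xs

restrict : ∀ {k} {ℓ : Form (suc k)} → Pivot ℓ → Form (suc k) → Form k
restrict (here {a = a} {ℓ = ℓ} _) (b ∷ m) = scaleAdd (b ⊗ ⊖ a) ℓ m
restrict (there p) (b ∷ m) = b ∷ restrict p m

eval-restrict : ∀ {n k} {ℓ : Form (suc k)} (p : Pivot ℓ) (m : Form (suc k)) (xs : Vec (F3^ n) k) →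
  eval m (solveFor p xs) ≡ eval (restrict p m) xs
eval-restrict (here {a = a} {ℓ = ℓ} _) (b ∷ m) xs =
  trans (cong (_+v eval m xs) (·-assoc b (⊖ a) (eval ℓ xs))) (sym (eval-scaleAdd (b ⊗ ⊖ a) ℓ m xs))
eval-restrict (there p) (b ∷ m) (x ∷ xs) = cong (b · x +v_) (eval-restrict p m xs)

𝟙 : ∀ {p} {P : Set p} → Dec P → ℕ
𝟙 d = if does d then 1 else 0

𝟙-yes : ∀ {p} {P : Set p} (d : Dec P) → P → 𝟙 d ≡ 1
𝟙-yes (yes _) _ = refl
𝟙-yes (no ¬p) p = ⊥-elim (¬p p)

𝟙-no : ∀ {p} {P : Set p} (d : Dec P) → ¬ P → 𝟙 d ≡ 0
𝟙-no (yes p) ¬p = ⊥-elim (¬p p)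
𝟙-no (no _) _ = refl

𝟙-cong : ∀ {p q} {P : Set p} {Q : Set q} (d : Dec P) (e : Dec Q) → P ⇔ Q → 𝟙 d ≡ 𝟙 e
𝟙-cong (yes p) e P⇔Q = sym (𝟙-yes e (Equivalence.to P⇔Q p))
𝟙-cong (no ¬p) e P⇔Q = sym (𝟙-no e (λ q → ¬p (Equivalence.from P⇔Q q)))

𝟙-¬?+𝟙 : ∀ {p} {P : Set p} (d : Dec P) → 𝟙 (¬? d) ℕ.+ 𝟙 d ≡ 1
𝟙-¬?+𝟙 (yes _) = refl
𝟙-¬?+𝟙 (no _) = refl

𝟙-×-dec : ∀ {p q} {P : Set p} {Q : Set q} (d : Dec P) (e : Dec Q) → 𝟙 (d ×-dec e) ≡ 𝟙 d ℕ.* 𝟙 e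
𝟙-×-dec (yes _) (yes _) = refl
𝟙-×-dec (yes _) (no _) = refl
𝟙-×-dec (no _) _ = refl

𝟙≤1 : ∀ {p} {P : Set p} (d : Dec P) → 𝟙 d ≤ 1
𝟙≤1 (yes _) = s≤s z≤n
𝟙≤1 (no _) = z≤n

∑ : ∀ {A : Set} → (A → ℕ) → List A → ℕ
∑ g xs = sum (map g xs)

∑-++ : ∀ {A : Set} (g : A → ℕ) xs ys → ∑ g (xs ++ ys) ≡ ∑ g xs ℕ.+ ∑ g ys
∑-++ g xs ys = trans (cong sum (List.map-++ g xs ys)) (sum-++ (map g xs) (map g ys))

∑-map : ∀ {A B : Set} (g : B → ℕ) (h : A → B) xs → ∑ g (map h xs) ≡ ∑ (λ x → g (h x)) xs
∑-map g h xs = cong sum (sym (List.map-∘ xs))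

∑-concatMap : ∀ {A B : Set} (g : B → ℕ) (h : A → List B) xs →
  ∑ g (concatMap h xs) ≡ ∑ (λ x → ∑ g (h x)) xs
∑-concatMap g h [] = refl
∑-concatMap g h (x ∷ xs) = trans (∑-++ g (h x) (concatMap h xs)) (cong (∑ g (h x) ℕ.+_) (∑-concatMap g h xs))

∑-cong : ∀ {A : Set} {g h : A → ℕ} → (∀ x → g x ≡ h x) → ∀ xs → ∑ g xs ≡ ∑ h xs
∑-cong g≗h xs = cong sum (List.map-cong g≗h xs)

∑-zero : ∀ {A : Set} (g : A → ℕ) → (∀ x → g x ≡ 0) → ∀ xs → ∑ g xs ≡ 0
∑-zero g g≗0 [] = refl
∑-zero g g≗0 (x ∷ xs) = cong₂ ℕ._+_ (g≗0 x) (∑-zero g g≗0 xs)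

∑-+ : ∀ {A : Set} (g h : A → ℕ) xs → ∑ (λ x → g x ℕ.+ h x) xs ≡ ∑ g xs ℕ.+ ∑ h xs
∑-+ g h [] = refl
∑-+ g h (x ∷ xs) = trans (cong (g x ℕ.+ h x ℕ.+_) (∑-+ g h xs)) (+-interchange (g x) (h x) (∑ g xs) (∑ h xs))
  where
  +-interchange : ∀ a b c d → (a ℕ.+ b) ℕ.+ (c ℕ.+ d) ≡ (a ℕ.+ c) ℕ.+ (b ℕ.+ d)
  +-interchange = ℕ.solve-∀

∑-*ˡ : ∀ {A : Set} c (g : A → ℕ) xs → ∑ (λ x → c ℕ.* g x) xs ≡ c ℕ.* ∑ g xs
∑-*ˡ c g [] = sym (ℕ.*-zeroʳ c)
∑-*ˡ c g (x ∷ xs) = trans (cong (c ℕ.* g x ℕ.+_) (∑-*ˡ c g xs)) (sym (ℕ.*-distribˡ-+ c (g x) (∑ g xs)))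

∑-swap : ∀ {A B : Set} (g : A → B → ℕ) xs ys →
  ∑ (λ x → ∑ (g x) ys) xs ≡ ∑ (λ y → ∑ (λ x → g x y) xs) ys
∑-swap g [] ys = sym (∑-zero _ (λ _ → refl) ys)
∑-swap g (x ∷ xs) ys =
  trans (cong (∑ (g x) ys ℕ.+_) (∑-swap g xs ys)) (sym (∑-+ (g x) (λ y → ∑ (λ x′ → g x′ y) xs) ys))

∑-mono : ∀ {A : Set} {g h : A → ℕ} → (∀ x → g x ≤ h x) → ∀ xs → ∑ g xs ≤ ∑ h xs
∑-mono g≤h [] = z≤n
∑-mono g≤h (x ∷ xs) = ℕ.+-mono-≤ (g≤h x) (∑-mono g≤h xs)

length-filter : ∀ {A : Set} {P : A → Set} (P? : ∀ x → Dec (P x)) xs →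
  length (filter P? xs) ≡ ∑ (λ x → 𝟙 (P? x)) xs
length-filter P? [] = refl
length-filter P? (x ∷ xs) with P? x
... | yes _ = cong suc (length-filter P? xs)
... | no _ = length-filter P? xs

∑ᵥ : ∀ n → (F3^ n → ℕ) → ℕ
∑ᵥ n g = ∑ g (allVecs n)

∑Points : ∀ n k → (Vec (F3^ n) k → ℕ) → ℕ
∑Points n zero w = w []
∑Points n (suc k) w = ∑ᵥ n (λ x → ∑Points n k (λ xs → w (x ∷ xs)))

∑ᵥ-∷ : ∀ {n} (g : F3^ (suc n) → ℕ) → ∑ᵥ (suc n) g ≡ ∑ (λ b → ∑ᵥ n (λ x → g (b ∷ x))) (List.allFin 3)
∑ᵥ-∷ {n} g = trans (∑-concatMap g (λ b → map (b ∷_) (allVecs n)) (List.allFin 3))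
                   (∑-cong (λ b → ∑-map g (b ∷_) (allVecs n)) (List.allFin 3))

∑ᵥ-const : ∀ n c → ∑ᵥ n (λ _ → c) ≡ 3 ℕ.^ n ℕ.* c
∑ᵥ-const zero c = refl
∑ᵥ-const (suc n) c = begin
  ∑ᵥ (suc n) (λ _ → c)                           ≡⟨ ∑ᵥ-∷ {n} (λ _ → c) ⟩
  ∑ (λ _ → ∑ᵥ n (λ _ → c)) (List.allFin 3)     ≡⟨ ∑-cong (λ _ → ∑ᵥ-const n c) (List.allFin 3) ⟩
  3 ℕ.* (3 ℕ.^ n ℕ.* c)                           ≡⟨ ℕ.*-assoc 3 (3 ℕ.^ n) c ⟨
  3 ℕ.^ suc n ℕ.* c                               ∎
  where open ≡-Reasoning

∑𝔽-delta : ∀ (h : 𝔽 → ℕ) c → ∑ (λ b → 𝟙 (b Fin.≟ c) ℕ.* h b) (List.allFin 3) ≡ h c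
∑𝔽-delta h 0F = pick (h 0F) (h 1F) (h 2F)
  where
  pick : ∀ x y z → 1 ℕ.* x ℕ.+ (0 ℕ.* y ℕ.+ (0 ℕ.* z ℕ.+ 0)) ≡ x
  pick = ℕ.solve-∀
∑𝔽-delta h 1F = pick (h 0F) (h 1F) (h 2F)
  where
  pick : ∀ x y z → 0 ℕ.* x ℕ.+ (1 ℕ.* y ℕ.+ (0 ℕ.* z ℕ.+ 0)) ≡ y
  pick = ℕ.solve-∀
∑𝔽-delta h 2F = pick (h 0F) (h 1F) (h 2F)
  where
  pick : ∀ x y z → 0 ℕ.* x ℕ.+ (0 ℕ.* y ℕ.+ (1 ℕ.* z ℕ.+ 0)) ≡ z
  pick = ℕ.solve-∀

∑ᵥ-delta : ∀ {n} (g : F3^ n → ℕ) v → ∑ᵥ n (λ x → 𝟙 (x ≟ v) ℕ.* g x) ≡ g v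
∑ᵥ-delta {zero} g [] = trans (ℕ.+-identityʳ _) (ℕ.+-identityʳ (g []))
∑ᵥ-delta {suc n} g (c ∷ v) = begin
  ∑ᵥ (suc n) (λ x → 𝟙 (x ≟ c ∷ v) ℕ.* g x)
    ≡⟨ ∑ᵥ-∷ {n} (λ x → 𝟙 (x ≟ c ∷ v) ℕ.* g x) ⟩
  ∑ (λ b → ∑ᵥ n (λ x → 𝟙 (b ∷ x ≟ c ∷ v) ℕ.* g (b ∷ x))) (List.allFin 3)
    ≡⟨ ∑-cong (λ b → trans (∑-cong (λ x → split b x) (allVecs n))
                           (∑-*ˡ (𝟙 (b Fin.≟ c)) _ (allVecs n))) (List.allFin 3) ⟩
  ∑ (λ b → 𝟙 (b Fin.≟ c) ℕ.* ∑ᵥ n (λ x → 𝟙 (x ≟ v) ℕ.* g (b ∷ x))) (List.allFin 3)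
    ≡⟨ ∑𝔽-delta (λ b → ∑ᵥ n (λ x → 𝟙 (x ≟ v) ℕ.* g (b ∷ x))) c ⟩
  ∑ᵥ n (λ x → 𝟙 (x ≟ v) ℕ.* g (c ∷ x))
    ≡⟨ ∑ᵥ-delta (λ x → g (c ∷ x)) v ⟩
  g (c ∷ v) ∎
  where
  open ≡-Reasoning
  split : ∀ b x → 𝟙 (b ∷ x ≟ c ∷ v) ℕ.* g (b ∷ x) ≡ 𝟙 (b Fin.≟ c) ℕ.* (𝟙 (x ≟ v) ℕ.* g (b ∷ x))
  split b x = trans (cong (ℕ._* g (b ∷ x)) (𝟙-×-dec (b Fin.≟ c) (x ≟ v))) (ℕ.*-assoc (𝟙 (b Fin.≟ c)) _ _)

∑ᵥ-root : ∀ {n} a (e : F3^ n) (g : F3^ n → ℕ) → a ≢ 0F →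
  ∑ᵥ n (λ x → 𝟙 (a · x +v e ≟ 0v) ℕ.* g x) ≡ g (⊖ a · e)
∑ᵥ-root {n} a e g a≢0 =
  trans (∑-cong (λ x → cong (ℕ._* g x) (𝟙-cong (a · x +v e ≟ 0v) (x ≟ ⊖ a · e) (a·x+e≡0⇔x≡⊖a·e a x e a≢0))) (allVecs n))
        (∑ᵥ-delta g (⊖ a · e))

∑Points-cong : ∀ {n} k {w w′ : Vec (F3^ n) k → ℕ} → (∀ xs → w xs ≡ w′ xs) → ∑Points n k w ≡ ∑Points n k w′
∑Points-cong zero w≗w′ = w≗w′ []
∑Points-cong {n} (suc k) w≗w′ = ∑-cong (λ x → ∑Points-cong k (λ xs → w≗w′ (x ∷ xs))) (allVecs n)

∑Points-+ : ∀ {n} k (w w′ : Vec (F3^ n) k → ℕ) → ∑Points n k (λ xs → w xs ℕ.+ w′ xs) ≡ ∑Points n k w ℕ.+ ∑Points n k w′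
∑Points-+ zero w w′ = refl
∑Points-+ {n} (suc k) w w′ =
  trans (∑-cong (λ x → ∑Points-+ k (λ xs → w (x ∷ xs)) (λ xs → w′ (x ∷ xs))) (allVecs n))
        (∑-+ (λ x → ∑Points n k (λ xs → w (x ∷ xs))) (λ x → ∑Points n k (λ xs → w′ (x ∷ xs))) (allVecs n))

∑Points-swap : ∀ {n} k (g : F3^ n → Vec (F3^ n) k → ℕ) →
  ∑Points n k (λ xs → ∑ᵥ n (λ x → g x xs)) ≡ ∑ᵥ n (λ x → ∑Points n k (g x))
∑Points-swap zero g = refl
∑Points-swap {n} (suc k) g =
  trans (∑-cong (λ y → ∑Points-swap k (λ x xs → g x (y ∷ xs))) (allVecs n))
        (∑-swap (λ y x → ∑Points n k (λ xs → g x (y ∷ xs))) (allVecs n) (allVecs n))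

∑Points-zero : ∀ {n} k (w : Vec (F3^ n) k → ℕ) → (∀ xs → w xs ≡ 0) → ∑Points n k w ≡ 0
∑Points-zero zero w w≗0 = w≗0 []
∑Points-zero {n} (suc k) w w≗0 =
  trans (∑-cong (λ x → ∑Points-zero k _ (λ xs → w≗0 (x ∷ xs))) (allVecs n)) (∑-zero _ (λ _ → refl) (allVecs n))

∑Points-mono : ∀ {n} k {w w′ : Vec (F3^ n) k → ℕ} → (∀ xs → w xs ≤ w′ xs) → ∑Points n k w ≤ ∑Points n k w′
∑Points-mono zero w≤w′ = w≤w′ []
∑Points-mono {n} (suc k) w≤w′ = ∑-mono (λ x → ∑Points-mono k (λ xs → w≤w′ (x ∷ xs))) (allVecs n)

∑Points-1 : ∀ {n} k → ∑Points n k (λ _ → 1) ≡ (3 ℕ.^ n) ℕ.^ k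
∑Points-1 zero = refl
∑Points-1 {n} (suc k) =
  trans (∑-cong (λ _ → ∑Points-1 k) (allVecs n)) (∑ᵥ-const n ((3 ℕ.^ n) ℕ.^ k))

∑Points-insertAt : ∀ {n} k (r : Fin (suc k)) (w : Vec (F3^ n) (suc k) → ℕ) →
  ∑Points n (suc k) w ≡ ∑ᵥ n (λ x → ∑Points n k (λ xs → w (insertAt xs r x)))
∑Points-insertAt k Fin.zero w = refl
∑Points-insertAt {n} (suc k) (Fin.suc r) w =
  trans (∑-cong (λ y → ∑Points-insertAt k r (λ xs → w (y ∷ xs))) (allVecs n))
        (∑-swap (λ y x → ∑Points n k (λ xs → w (y ∷ insertAt xs r x))) (allVecs n) (allVecs n))

∑-allTuples : ∀ {n} k (w : Vec (F3^ n) k → ℕ) → ∑ w (allTuples (allVecs n) k) ≡ ∑Points n k w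
∑-allTuples zero w = ℕ.+-identityʳ (w [])
∑-allTuples {n} (suc k) w =
  trans (∑-concatMap w (λ x → map (x ∷_) (allTuples (allVecs n) k)) (allVecs n))
        (∑-cong (λ x → trans (∑-map w (x ∷_) (allTuples (allVecs n) k)) (∑-allTuples k (λ xs → w (x ∷ xs))))
                (allVecs n))

∑Points-hyperplane : ∀ {n k} {ℓ : Form (suc k)} (p : Pivot ℓ) (w : Vec (F3^ n) (suc k) → ℕ) →
  ∑Points n (suc k) (λ xs → 𝟙 (eval ℓ xs ≟ 0v) ℕ.* w xs) ≡ ∑Points n k (λ xs → w (solveFor p xs))
∑Points-hyperplane {n} {k} (here {a = a} {ℓ = ℓ} a≢0) w =
  trans (sym (∑Points-swap k (λ x xs → 𝟙 (a · x +v eval ℓ xs ≟ 0v) ℕ.* w (x ∷ xs))))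
        (∑Points-cong k (λ xs → ∑ᵥ-root a (eval ℓ xs) (λ x → w (x ∷ xs)) a≢0))
∑Points-hyperplane {n} {suc k} (there {ℓ = ℓ} p) w =
  ∑-cong (λ x → trans (∑Points-cong (suc k) (λ xs → cong (λ z → 𝟙 (z ≟ 0v) ℕ.* w (x ∷ xs)) (drop x xs)))
                      (∑Points-hyperplane p (λ xs → w (x ∷ xs))))
         (allVecs n)
  where
  drop : ∀ x xs → 0F · x +v eval ℓ xs ≡ eval ℓ xs
  drop x xs = trans (cong (_+v eval ℓ xs) (·-zeroˡ x)) (+v-identityˡ (eval ℓ xs))

-- Deletion–restriction

sumℤ-cong : ∀ m {g h : ℕ → ℤ} → (∀ i → g i ≡ h i) → sumℤ m g ≡ sumℤ m h
sumℤ-cong zero g≗h = g≗h 0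
sumℤ-cong (suc m) g≗h = cong₂ _+_ (sumℤ-cong m g≗h) (g≗h (suc m))

sumℤ-+ : ∀ m (g h : ℕ → ℤ) → sumℤ m (λ i → g i + h i) ≡ sumℤ m g + sumℤ m h
sumℤ-+ zero g h = refl
sumℤ-+ (suc m) g h =
  trans (cong (_+ (g (suc m) + h (suc m))) (sumℤ-+ m g h)) (interchange (sumℤ m g) (sumℤ m h) (g (suc m)) (h (suc m)))
  where
  interchange : ∀ a b c d → (a + b) + (c + d) ≡ (a + c) + (b + d)
  interchange = solve-∀

sumℤ-neg : ∀ m (g : ℕ → ℤ) → sumℤ m (λ i → - g i) ≡ - sumℤ m g
sumℤ-neg zero g = refl
sumℤ-neg (suc m) g = trans (cong (_+ - g (suc m)) (sumℤ-neg m g)) (sym (ℤ.neg-distrib-+ (sumℤ m g) (g (suc m))))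

sumℤ-suc : ∀ m (g : ℕ → ℤ) → sumℤ (suc m) g ≡ g 0 + sumℤ m (λ i → g (suc i))
sumℤ-suc zero g = refl
sumℤ-suc (suc m) g = trans (cong (_+ g (suc (suc m))) (sumℤ-suc m g)) (ℤ.+-assoc (g 0) _ _)

sumℤ-zero : ∀ m (g : ℕ → ℤ) → (∀ i → g i ≡ + 0) → sumℤ m g ≡ + 0
sumℤ-zero zero g g≗0 = g≗0 0
sumℤ-zero (suc m) g g≗0 = cong₂ _+_ (sumℤ-zero m g g≗0) (g≗0 (suc m))

sign : ℕ → ℤ
sign i = -[1+ 0 ] ^ i

pos-^ : ∀ m k → + (m ℕ.^ k) ≡ (+ m) ^ k
pos-^ m zero = refl
pos-^ m (suc k) = trans (ℤ.pos-* m (m ℕ.^ k)) (cong (+ m *_) (pos-^ m k))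

δ₀ : ℕ → ℕ
δ₀ zero = 1
δ₀ (suc _) = 0

shift : (ℕ → ℕ) → ℕ → ℕ
shift c zero = 0
shift c (suc i) = c i

*0*≡0 : ∀ s Q → s * + 0 * Q ≡ + 0
*0*≡0 s Q = trans (cong (_* Q) (ℤ.*-zeroʳ s)) (ℤ.*-zeroˡ Q)

altPoly-δ₀ : ∀ k q → altPoly k δ₀ q ≡ q ^ k
altPoly-δ₀ zero q = refl
altPoly-δ₀ (suc k) q = begin
  altPoly (suc k) δ₀ q
    ≡⟨ sumℤ-suc k _ ⟩
  + 1 * + 1 * q ^ suc k + sumℤ k (λ i → sign (suc i) * + 0 * q ^ (k ∸ i))
    ≡⟨ cong₂ _+_ (ℤ.*-identityˡ (q ^ suc k)) (sumℤ-zero k _ (λ i → *0*≡0 (sign (suc i)) (q ^ (k ∸ i)))) ⟩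
  q ^ suc k + + 0
    ≡⟨ ℤ.+-identityʳ (q ^ suc k) ⟩
  q ^ suc k ∎
  where open ≡-Reasoning

altPoly-zero : ∀ k q → altPoly k (λ _ → 0) q ≡ + 0
altPoly-zero k q = sumℤ-zero k _ (λ i → *0*≡0 (sign i) (q ^ (k ∸ i)))

altPoly-+shift : ∀ k (a b : ℕ → ℕ) q →
  altPoly (suc k) (λ i → a i ℕ.+ shift b i) q ≡ altPoly (suc k) a q - altPoly k b q
altPoly-+shift k a b q = begin
  altPoly (suc k) (λ i → a i ℕ.+ shift b i) q
    ≡⟨ sumℤ-cong (suc k) (λ i → trans (cong (λ z → sign i * z * q ^ (suc k ∸ i)) (ℤ.pos-+ (a i) (shift b i)))
                                       (distrib (sign i) (+ a i) (+ shift b i) (q ^ (suc k ∸ i)))) ⟩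
  sumℤ (suc k) (λ i → sign i * + a i * q ^ (suc k ∸ i) + sign i * + shift b i * q ^ (suc k ∸ i))
    ≡⟨ sumℤ-+ (suc k) _ _ ⟩
  altPoly (suc k) a q + sumℤ (suc k) (λ i → sign i * + shift b i * q ^ (suc k ∸ i))
    ≡⟨ cong (_+_ (altPoly (suc k) a q)) (sumℤ-suc k _) ⟩
  altPoly (suc k) a q + (+ 1 * + 0 * q ^ suc k + sumℤ k (λ i → sign (suc i) * + b i * q ^ (k ∸ i)))
    ≡⟨ cong (λ z → altPoly (suc k) a q + (z + sumℤ k (λ i → sign (suc i) * + b i * q ^ (k ∸ i))))
            (*0*≡0 (+ 1) (q ^ suc k)) ⟩
  altPoly (suc k) a q + (+ 0 + sumℤ k (λ i → sign (suc i) * + b i * q ^ (k ∸ i)))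
    ≡⟨ cong (_+_ (altPoly (suc k) a q)) (ℤ.+-identityˡ _) ⟩
  altPoly (suc k) a q + sumℤ k (λ i → sign (suc i) * + b i * q ^ (k ∸ i))
    ≡⟨ cong (_+_ (altPoly (suc k) a q)) (trans (sumℤ-cong k (λ i → flip (sign i) (+ b i) (q ^ (k ∸ i)))) (sumℤ-neg k _)) ⟩
  altPoly (suc k) a q - altPoly k b q ∎
  where
  open ≡-Reasoning
  distrib : ∀ s c d Q → s * (c + d) * Q ≡ s * c * Q + s * d * Q
  distrib = solve-∀
  flip : ∀ s d Q → (-[1+ 0 ] * s) * d * Q ≡ - (s * d * Q)
  flip = solve-∀

avoids : ∀ {n k} → List (Form k) → Vec (F3^ n) k → ℕ
avoids [] xs = 1
avoids (ℓ ∷ L) xs = 𝟙 (¬? (eval ℓ xs ≟ 0v)) ℕ.* avoids L xs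

avoids-restrict : ∀ {n k} {ℓ : Form (suc k)} (p : Pivot ℓ) L (xs : Vec (F3^ n) k) →
  avoids L (solveFor p xs) ≡ avoids (map (restrict p) L) xs
avoids-restrict p [] xs = refl
avoids-restrict p (m ∷ L) xs =
  cong₂ ℕ._*_ (cong (λ z → 𝟙 (¬? (z ≟ 0v))) (eval-restrict p m xs)) (avoids-restrict p L xs)

avoids-deletion : ∀ {n k} (ℓ : Form k) L (xs : Vec (F3^ n) k) →
  avoids (ℓ ∷ L) xs ℕ.+ 𝟙 (eval ℓ xs ≟ 0v) ℕ.* avoids L xs ≡ avoids L xs
avoids-deletion ℓ L xs = begin
  𝟙 (¬? (eval ℓ xs ≟ 0v)) ℕ.* avoids L xs ℕ.+ 𝟙 (eval ℓ xs ≟ 0v) ℕ.* avoids L xs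
    ≡⟨ ℕ.*-distribʳ-+ (avoids L xs) (𝟙 (¬? (eval ℓ xs ≟ 0v))) (𝟙 (eval ℓ xs ≟ 0v)) ⟨
  (𝟙 (¬? (eval ℓ xs ≟ 0v)) ℕ.+ 𝟙 (eval ℓ xs ≟ 0v)) ℕ.* avoids L xs
    ≡⟨ cong (ℕ._* avoids L xs) (𝟙-¬?+𝟙 (eval ℓ xs ≟ 0v)) ⟩
  1 ℕ.* avoids L xs
    ≡⟨ ℕ.*-identityˡ (avoids L xs) ⟩
  avoids L xs ∎
  where open ≡-Reasoning

-- coeff⁺ k is coeff (suc k), split off so that the recursion on the number of variables and on
-- the list is structural.
mutual
  coeff : ∀ k → List (Form k) → ℕ → ℕ
  coeff zero [] = δ₀
  coeff zero (_ ∷ _) _ = 0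
  coeff (suc k) = coeff⁺ k

  coeff⁺ : ∀ k → List (Form (suc k)) → ℕ → ℕ
  coeff⁺ k [] = δ₀
  coeff⁺ k (ℓ ∷ L) i with pivot? ℓ
  ... | inj₁ p = coeff⁺ k L i ℕ.+ shift (coeff k (map (restrict p) L)) i
  ... | inj₂ _ = 0

count-avoids-[] : ∀ {n} k → + ∑Points n k (λ _ → 1) ≡ altPoly k δ₀ (+ (3 ℕ.^ n))
count-avoids-[] {n} k = begin
  + ∑Points n k (λ _ → 1)   ≡⟨ cong +_ (∑Points-1 k) ⟩
  + ((3 ℕ.^ n) ℕ.^ k)    ≡⟨ pos-^ (3 ℕ.^ n) k ⟩
  (+ (3 ℕ.^ n)) ^ k      ≡⟨ altPoly-δ₀ k (+ (3 ℕ.^ n)) ⟨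
  altPoly k δ₀ (+ (3 ℕ.^ n)) ∎
  where open ≡-Reasoning

count-deletion-restriction : ∀ {n k} {ℓ : Form (suc k)} (p : Pivot ℓ) (L : List (Form (suc k))) →
  ∑Points n (suc k) (avoids (ℓ ∷ L)) ℕ.+ ∑Points n k (avoids (map (restrict p) L)) ≡ ∑Points n (suc k) (avoids L)
count-deletion-restriction {n} {k} {ℓ} p L = begin
  ∑Points n (suc k) (avoids (ℓ ∷ L)) ℕ.+ ∑Points n k (avoids (map (restrict p) L))
    ≡⟨ cong (∑Points n (suc k) (avoids (ℓ ∷ L)) ℕ.+_)
            (trans (∑Points-cong k (λ xs → sym (avoids-restrict p L xs))) (sym (∑Points-hyperplane p (avoids L)))) ⟩
  ∑Points n (suc k) (avoids (ℓ ∷ L)) ℕ.+ ∑Points n (suc k) (λ xs → 𝟙 (eval ℓ xs ≟ 0v) ℕ.* avoids L xs)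
    ≡⟨ ∑Points-+ {n} (suc k) (avoids (ℓ ∷ L)) (λ xs → 𝟙 (eval ℓ xs ≟ 0v) ℕ.* avoids L xs) ⟨
  ∑Points n (suc k) (λ xs → avoids (ℓ ∷ L) xs ℕ.+ 𝟙 (eval ℓ xs ≟ 0v) ℕ.* avoids L xs)
    ≡⟨ ∑Points-cong {n} (suc k) (avoids-deletion ℓ L) ⟩
  ∑Points n (suc k) (avoids L) ∎
  where open ≡-Reasoning

count-avoids : ∀ {n} k (L : List (Form k)) → + ∑Points n k (avoids L) ≡ altPoly k (coeff k L) (+ (3 ℕ.^ n))
count-avoids {n} zero [] = count-avoids-[] {n} zero
count-avoids zero (ℓ ∷ L) = cong (λ z → + (z ℕ.* avoids L [])) (𝟙-no (¬? (eval ℓ [] ≟ 0v)) (λ ℓ≢0 → ℓ≢0 (vanish ℓ)))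
  where
  vanish : ∀ (ℓ : Form 0) → eval ℓ [] ≡ 0v
  vanish [] = refl
count-avoids {n} (suc k) = go
  where
  q = + (3 ℕ.^ n)
  go : (L : List (Form (suc k))) → + ∑Points n (suc k) (avoids L) ≡ altPoly (suc k) (coeff⁺ k L) q
  go [] = count-avoids-[] {n} (suc k)
  go (ℓ ∷ L) with pivot? ℓ
  ... | inj₂ refl = trans (cong +_ (∑Points-zero {n} (suc k) _ (λ xs → cong (ℕ._* avoids L xs)
                            (𝟙-no (¬? (eval zeroForm xs ≟ 0v)) (λ ℓ≢0 → ℓ≢0 (eval-zeroForm xs))))))
                          (sym (altPoly-zero (suc k) _))
  ... | inj₁ p = begin
    + ∑Points n (suc k) (avoids (ℓ ∷ L))
      ≡⟨ m≡[m+n]-n (∑Points n (suc k) (avoids (ℓ ∷ L))) (∑Points n k (avoids L′)) ⟩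
    + (∑Points n (suc k) (avoids (ℓ ∷ L)) ℕ.+ ∑Points n k (avoids L′)) - + ∑Points n k (avoids L′)
      ≡⟨ cong (λ m → + m - + ∑Points n k (avoids L′)) (count-deletion-restriction p L) ⟩
    + ∑Points n (suc k) (avoids L) - + ∑Points n k (avoids L′)
      ≡⟨ cong₂ _-_ (go L) (count-avoids k L′) ⟩
    altPoly (suc k) (coeff⁺ k L) q - altPoly k (coeff k L′) q
      ≡⟨ altPoly-+shift k _ _ q ⟨
    altPoly (suc k) (λ i → coeff⁺ k L i ℕ.+ shift (coeff k L′) i) q ∎
    where
    open ≡-Reasoning
    L′ = map (restrict p) L
    m≡[m+n]-n : ∀ m n → + m ≡ + (m ℕ.+ n) - + n
    m≡[m+n]-n m n = trans (cancel (+ m) (+ n)) (cong (_- + n) (sym (ℤ.pos-+ m n)))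
      where
      cancel : ∀ a b → a ≡ (a + b) - b
      cancel = solve-∀

coeff-leading : ∀ k (L : List (Form k)) → All (_≢ zeroForm) L → coeff k L 0 ≡ 1
coeff-leading zero [] _ = refl
coeff-leading zero ([] ∷ L) (ℓ≢0 ∷ _) = ⊥-elim (ℓ≢0 refl)
coeff-leading (suc k) = go
  where
  go : ∀ L → All (_≢ zeroForm) L → coeff⁺ k L 0 ≡ 1
  go [] _ = refl
  go (ℓ ∷ L) (ℓ≢0 ∷ L≢0) with pivot? ℓ
  ... | inj₁ p = trans (ℕ.+-identityʳ _) (go L L≢0)
  ... | inj₂ ℓ≡0 = ⊥-elim (ℓ≢0 ℓ≡0)

coeff-vanish : ∀ k (L : List (Form k)) i → k < i → coeff k L i ≡ 0
coeff-vanish zero [] (suc i) _ = refl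
coeff-vanish zero (ℓ ∷ L) i _ = refl
coeff-vanish (suc k) L (suc i) (s≤s k<i) = go L
  where
  go : ∀ L → coeff⁺ k L (suc i) ≡ 0
  go [] = refl
  go (ℓ ∷ L) with pivot? ℓ
  ... | inj₁ p = cong₂ ℕ._+_ (go L) (coeff-vanish k (map (restrict p) L) i k<i)
  ... | inj₂ _ = refl

-- Coranks and Whitney's formula

solves : ∀ {n k} → List (Form k) → Vec (F3^ n) k → ℕ
solves [] xs = 1
solves (ℓ ∷ E) xs = 𝟙 (eval ℓ xs ≟ 0v) ℕ.* solves E xs

solves-restrict : ∀ {n k} {ℓ : Form (suc k)} (p : Pivot ℓ) E (xs : Vec (F3^ n) k) →
  solves E (solveFor p xs) ≡ solves (map (restrict p) E) xs
solves-restrict p [] xs = refl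
solves-restrict p (m ∷ E) xs = cong₂ ℕ._*_ (cong (λ z → 𝟙 (z ≟ 0v)) (eval-restrict p m xs)) (solves-restrict p E xs)

mutual
  corank : ∀ k → List (Form k) → ℕ
  corank zero _ = 0
  corank (suc k) = corank⁺ k

  corank⁺ : ∀ k → List (Form (suc k)) → ℕ
  corank⁺ k [] = suc k
  corank⁺ k (ℓ ∷ E) with pivot? ℓ
  ... | inj₁ p = corank k (map (restrict p) E)
  ... | inj₂ _ = corank⁺ k E

corank⁺-pivot : ∀ {k} {ℓ : Form (suc k)} {p} E → pivot? ℓ ≡ inj₁ p → corank⁺ k (ℓ ∷ E) ≡ corank k (map (restrict p) E)
corank⁺-pivot E eq rewrite eq = refl

corank⁺-zero : ∀ {k} (ℓ : Form (suc k)) E → ℓ ≡ zeroForm → corank⁺ k (ℓ ∷ E) ≡ corank⁺ k E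
corank⁺-zero ℓ E ℓ≡0 with pivot? ℓ
... | inj₁ p = ⊥-elim (Pivot⇒≢zeroForm p ℓ≡0)
... | inj₂ _ = refl

count-solves : ∀ {n} k (E : List (Form k)) → ∑Points n k (solves E) ≡ (3 ℕ.^ n) ℕ.^ corank k E
count-solves zero E = nullary E
  where
  nullary : ∀ {n} (E : List (Form 0)) → solves {n} E [] ≡ 1
  nullary [] = refl
  nullary {n} ([] ∷ E) =
    trans (cong (ℕ._* solves {n} E []) (𝟙-yes (0v {n} ≟ 0v) refl)) (trans (ℕ.*-identityˡ (solves {n} E [])) (nullary E))
count-solves {n} (suc k) = go
  where
  go : ∀ E → ∑Points n (suc k) (solves E) ≡ (3 ℕ.^ n) ℕ.^ corank⁺ k E
  go [] = ∑Points-1 {n} (suc k)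
  go (ℓ ∷ E) with pivot? ℓ
  ... | inj₁ p = trans (∑Points-hyperplane p (solves E))
                       (trans (∑Points-cong {n} k (solves-restrict p E)) (count-solves k (map (restrict p) E)))
  ... | inj₂ refl = trans (∑Points-cong (suc k) on0) (go E)
    where
    on0 : ∀ (xs : Vec (F3^ n) (suc k)) → solves (zeroForm ∷ E) xs ≡ solves E xs
    on0 xs = trans (cong (λ z → 𝟙 (z ≟ 0v) ℕ.* solves E xs) (eval-zeroForm xs))
                   (trans (cong (ℕ._* solves E xs) (𝟙-yes (0v {n} ≟ 0v) refl)) (ℕ.*-identityˡ (solves E xs)))

corank≤ : ∀ k (E : List (Form k)) → corank k E ≤ k
corank≤ zero E = z≤n
corank≤ (suc k) = go
  where
  go : ∀ E → corank⁺ k E ≤ suc k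
  go [] = ℕ.≤-refl
  go (ℓ ∷ E) with pivot? ℓ
  ... | inj₁ p = ℕ.m≤n⇒m≤1+n (corank≤ k (map (restrict p) E))
  ... | inj₂ _ = go E

3^-cancel-≤ : ∀ {a b} → 3 ℕ.^ a ≤ 3 ℕ.^ b → a ≤ b
3^-cancel-≤ {a} {b} 3^a≤3^b with ℕ.≤-<-connex a b
... | inj₁ a≤b = a≤b
... | inj₂ b<a = ⊥-elim (ℕ.<⇒≱ (ℕ.^-monoʳ-< 3 (s≤s (s≤s z≤n)) b<a) 3^a≤3^b)

3^-injective : ∀ {a b} → 3 ℕ.^ a ≡ 3 ℕ.^ b → a ≡ b
3^-injective eq = ℕ.≤-antisym (3^-cancel-≤ (ℕ.≤-reflexive eq)) (3^-cancel-≤ (ℕ.≤-reflexive (sym eq)))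

-- Facts about coranks are read off from the number of solutions over 𝔽₃ (n = 1).
corank-∷-≤ : ∀ k (ℓ : Form k) E → corank k (ℓ ∷ E) ≤ corank k E
corank-∷-≤ k ℓ E = 3^-cancel-≤ (subst₂ _≤_ (count-solves {1} k (ℓ ∷ E)) (count-solves {1} k E)
  (∑Points-mono k (λ xs → ℕ.≤-trans (ℕ.*-monoˡ-≤ (solves E xs) (𝟙≤1 (eval ℓ xs ≟ 0v)))
                                   (ℕ.≤-reflexive (ℕ.*-identityˡ (solves E xs))))))

embed : ∀ {k} → Fin (suc k) → Form k → Form (suc k)
embed r ℓ = insertAt ℓ r 0F

eval-insertAt-removeAt : ∀ {n k} (m : Form (suc k)) (r : Fin (suc k)) (xs : Vec (F3^ n) k) x →
  eval m (insertAt xs r x) ≡ lookup m r · x +v eval (removeAt m r) xs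
eval-insertAt-removeAt m r xs x =
  trans (cong (λ z → eval z (insertAt xs r x)) (sym (Vec.insertAt-removeAt m r)))
        (eval-insertAt (removeAt m r) r (lookup m r) xs x)

solves-removeAt : ∀ {n k} (r : Fin (suc k)) (E : List (Form (suc k))) → All (λ m → lookup m r ≡ 0F) E →
  ∀ (xs : Vec (F3^ n) k) x → solves E (insertAt xs r x) ≡ solves (map (λ m → removeAt m r) E) xs
solves-removeAt r [] [] xs x = refl
solves-removeAt r (m ∷ E) (m[r]≡0 ∷ E[r]≡0) xs x = cong₂ ℕ._*_ (cong (λ z → 𝟙 (z ≟ 0v)) eval≡) (solves-removeAt r E E[r]≡0 xs x)
  where
  eval≡ : eval m (insertAt xs r x) ≡ eval (removeAt m r) xs
  eval≡ = trans (eval-insertAt-removeAt m r xs x)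
                (trans (cong (λ c → c · x +v eval (removeAt m r) xs) m[r]≡0)
                       (trans (cong (_+v eval (removeAt m r) xs) (·-zeroˡ x)) (+v-identityˡ _)))

count-solves-free : ∀ {n k} (r : Fin (suc k)) (E : List (Form (suc k))) → All (λ m → lookup m r ≡ 0F) E →
  ∑Points n (suc k) (solves E) ≡ 3 ℕ.^ n ℕ.* ∑Points n k (solves (map (λ m → removeAt m r) E))
count-solves-free {n} {k} r E E[r]≡0 =
  trans (∑Points-insertAt {n} k r (solves E))
        (trans (∑-cong (λ x → ∑Points-cong {n} k (λ xs → solves-removeAt r E E[r]≡0 xs x)) (allVecs n))
               (∑ᵥ-const n _))

count-solves-fresh : ∀ {n k} (r : Fin (suc k)) (ℓ : Form (suc k)) (E : List (Form (suc k))) →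
  lookup ℓ r ≢ 0F → All (λ m → lookup m r ≡ 0F) E →
  ∑Points n (suc k) (solves (ℓ ∷ E)) ≡ ∑Points n k (solves (map (λ m → removeAt m r) E))
count-solves-fresh {n} {k} r ℓ E ℓ[r]≢0 E[r]≡0 = begin
  ∑Points n (suc k) (solves (ℓ ∷ E))
    ≡⟨ ∑Points-insertAt {n} k r (solves (ℓ ∷ E)) ⟩
  ∑ᵥ n (λ x → ∑Points n k (λ xs → solves (ℓ ∷ E) (insertAt xs r x)))
    ≡⟨ ∑-cong (λ x → ∑Points-cong k (λ xs → cong₂ (λ z w → 𝟙 (z ≟ 0v) ℕ.* w)
                                                (eval-insertAt-removeAt ℓ r xs x) (solves-removeAt r E E[r]≡0 xs x)))
              (allVecs n) ⟩
  ∑ᵥ n (λ x → ∑Points n k (λ xs → 𝟙 (c · x +v eval ℓ′ xs ≟ 0v) ℕ.* solves E′ xs))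
    ≡⟨ ∑Points-swap k (λ x xs → 𝟙 (c · x +v eval ℓ′ xs ≟ 0v) ℕ.* solves E′ xs) ⟨
  ∑Points n k (λ xs → ∑ᵥ n (λ x → 𝟙 (c · x +v eval ℓ′ xs ≟ 0v) ℕ.* solves E′ xs))
    ≡⟨ ∑Points-cong k (λ xs → ∑ᵥ-root c (eval ℓ′ xs) (λ _ → solves E′ xs) ℓ[r]≢0) ⟩
  ∑Points n k (solves E′) ∎
  where
  open ≡-Reasoning
  c = lookup ℓ r
  ℓ′ = removeAt ℓ r
  E′ = map (λ m → removeAt m r) E

corank-embed : ∀ k (r : Fin (suc k)) (E : List (Form k)) → corank (suc k) (map (embed r) E) ≡ suc (corank k E)
corank-embed k r E = 3^-injective (begin
  3 ℕ.^ corank (suc k) (map (embed r) E)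
    ≡⟨ count-solves {1} (suc k) (map (embed r) E) ⟨
  ∑Points 1 (suc k) (solves (map (embed r) E))
    ≡⟨ count-solves-free {1} r (map (embed r) E) (Allₚ.map⁺ (All.tabulate λ {ℓ} _ → Vec.insertAt-lookup ℓ r 0F)) ⟩
  3 ℕ.* ∑Points 1 k (solves (map (λ m → removeAt m r) (map (embed r) E)))
    ≡⟨ cong (λ F → 3 ℕ.* ∑Points 1 k (solves F)) removeAt∘embed ⟩
  3 ℕ.* ∑Points 1 k (solves E)
    ≡⟨ cong (3 ℕ.*_) (count-solves {1} k E) ⟩
  3 ℕ.^ suc (corank k E) ∎)
  where
  open ≡-Reasoning
  removeAt∘embed : map (λ m → removeAt m r) (map (embed r) E) ≡ E
  removeAt∘embed = trans (sym (List.map-∘ E)) (List.map-id-local (All.tabulate λ {ℓ} _ → Vec.removeAt-insertAt ℓ r 0F))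

corank-fresh : ∀ {k} (r : Fin (suc k)) (ℓ : Form (suc k)) (E : List (Form (suc k))) →
  lookup ℓ r ≢ 0F → All (λ m → lookup m r ≡ 0F) E → suc (corank (suc k) (ℓ ∷ E)) ≡ corank (suc k) E
corank-fresh {k} r ℓ E ℓ[r]≢0 E[r]≡0 = 3^-injective (begin
  3 ℕ.* 3 ℕ.^ corank (suc k) (ℓ ∷ E)
    ≡⟨ cong (3 ℕ.*_) (count-solves {1} (suc k) (ℓ ∷ E)) ⟨
  3 ℕ.* ∑Points 1 (suc k) (solves (ℓ ∷ E))
    ≡⟨ cong (3 ℕ.*_) (count-solves-fresh {1} r ℓ E ℓ[r]≢0 E[r]≡0) ⟩
  3 ℕ.* ∑Points 1 k (solves (map (λ m → removeAt m r) E))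
    ≡⟨ count-solves-free {1} r E E[r]≡0 ⟨
  ∑Points 1 (suc k) (solves E)
    ≡⟨ count-solves {1} (suc k) E ⟩
  3 ℕ.^ corank (suc k) E ∎)
  where open ≡-Reasoning

∑ℤ : ∀ {A : Set} → (A → ℤ) → List A → ℤ
∑ℤ g [] = + 0
∑ℤ g (x ∷ xs) = g x + ∑ℤ g xs

∑ℤ-++ : ∀ {A : Set} (g : A → ℤ) xs ys → ∑ℤ g (xs ++ ys) ≡ ∑ℤ g xs + ∑ℤ g ys
∑ℤ-++ g [] ys = sym (ℤ.+-identityˡ _)
∑ℤ-++ g (x ∷ xs) ys = trans (cong (_+_ (g x)) (∑ℤ-++ g xs ys)) (sym (ℤ.+-assoc (g x) _ _))

∑ℤ-map : ∀ {A B : Set} (g : B → ℤ) (h : A → B) xs → ∑ℤ g (map h xs) ≡ ∑ℤ (λ x → g (h x)) xs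
∑ℤ-map g h [] = refl
∑ℤ-map g h (x ∷ xs) = cong (_+_ (g (h x))) (∑ℤ-map g h xs)

∑ℤ-cong : ∀ {A : Set} {g h : A → ℤ} → (∀ x → g x ≡ h x) → ∀ xs → ∑ℤ g xs ≡ ∑ℤ h xs
∑ℤ-cong g≗h [] = refl
∑ℤ-cong g≗h (x ∷ xs) = cong₂ _+_ (g≗h x) (∑ℤ-cong g≗h xs)

∑ℤ-neg : ∀ {A : Set} (g : A → ℤ) xs → ∑ℤ (λ x → - g x) xs ≡ - ∑ℤ g xs
∑ℤ-neg g [] = refl
∑ℤ-neg g (x ∷ xs) = trans (cong (_+_ (- g x)) (∑ℤ-neg g xs)) (sym (ℤ.neg-distrib-+ (g x) _))

∑ℤ-zero : ∀ {A : Set} (g : A → ℤ) → (∀ x → g x ≡ + 0) → ∀ xs → ∑ℤ g xs ≡ + 0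
∑ℤ-zero g g≗0 [] = refl
∑ℤ-zero g g≗0 (x ∷ xs) = cong₂ _+_ (g≗0 x) (∑ℤ-zero g g≗0 xs)

∑ℤ-+ : ∀ {A : Set} (g h : A → ℤ) xs → ∑ℤ (λ x → g x + h x) xs ≡ ∑ℤ g xs + ∑ℤ h xs
∑ℤ-+ g h [] = refl
∑ℤ-+ g h (x ∷ xs) = trans (cong (_+_ (g x + h x)) (∑ℤ-+ g h xs)) (interchange (g x) (h x) _ _)
  where
  interchange : ∀ a b c d → (a + b) + (c + d) ≡ (a + c) + (b + d)
  interchange = solve-∀

sublists : ∀ {A : Set} → List A → List (List A)
sublists [] = [] ∷ []
sublists (x ∷ xs) = sublists xs ++ map (x ∷_) (sublists xs)

∑ℤ-sublists-∷ : ∀ {A : Set} (g : List A → ℤ) x xs →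
  ∑ℤ g (sublists (x ∷ xs)) ≡ ∑ℤ g (sublists xs) + ∑ℤ (λ E → g (x ∷ E)) (sublists xs)
∑ℤ-sublists-∷ g x xs = trans (∑ℤ-++ g (sublists xs) _) (cong (_+_ (∑ℤ g (sublists xs))) (∑ℤ-map g (x ∷_) (sublists xs)))

∑ℤ-sublists-map : ∀ {A B : Set} (g : List B → ℤ) (f : A → B) xs →
  ∑ℤ g (sublists (map f xs)) ≡ ∑ℤ (λ E → g (map f E)) (sublists xs)
∑ℤ-sublists-map g f [] = refl
∑ℤ-sublists-map g f (x ∷ xs) = begin
  ∑ℤ g (sublists (f x ∷ map f xs))
    ≡⟨ ∑ℤ-sublists-∷ g (f x) (map f xs) ⟩
  ∑ℤ g (sublists (map f xs)) + ∑ℤ (λ E → g (f x ∷ E)) (sublists (map f xs))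
    ≡⟨ cong₂ _+_ (∑ℤ-sublists-map g f xs) (∑ℤ-sublists-map (λ E → g (f x ∷ E)) f xs) ⟩
  ∑ℤ (λ E → g (map f E)) (sublists xs) + ∑ℤ (λ E → g (f x ∷ map f E)) (sublists xs)
    ≡⟨ ∑ℤ-sublists-∷ (λ E → g (map f E)) x xs ⟨
  ∑ℤ (λ E → g (map f E)) (sublists (x ∷ xs)) ∎
  where open ≡-Reasoning

∑ℤ-sublists-filter : ∀ {A : Set} {P : A → Set} (P? : ∀ x → Dec (P x)) (g : List A → ℤ) xs →
  ∑ℤ (λ E → + 𝟙 (All.all? P? E) * g E) (sublists xs) ≡ ∑ℤ g (sublists (filter P? xs))
∑ℤ-sublists-filter P? g [] = cong (_+ + 0) (ℤ.*-identityˡ (g []))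
∑ℤ-sublists-filter P? g (x ∷ xs) with P? x
... | yes px = begin
  ∑ℤ (λ E → + 𝟙 (All.all? P? E) * g E) (sublists (x ∷ xs))
    ≡⟨ ∑ℤ-sublists-∷ _ x xs ⟩
  ∑ℤ (λ E → + 𝟙 (All.all? P? E) * g E) (sublists xs) + ∑ℤ (λ E → + 𝟙 (All.all? P? (x ∷ E)) * g (x ∷ E)) (sublists xs)
    ≡⟨ cong₂ _+_ (∑ℤ-sublists-filter P? g xs)
                 (trans (∑ℤ-cong (λ E → cong (λ z → + z * g (x ∷ E))
                                               (𝟙-cong (All.all? P? (x ∷ E)) (All.all? P? E) (mk⇔ All.tail (px ∷_))))
                                 (sublists xs))
                        (∑ℤ-sublists-filter P? (λ E → g (x ∷ E)) xs)) ⟩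
  ∑ℤ g (sublists (filter P? xs)) + ∑ℤ (λ E → g (x ∷ E)) (sublists (filter P? xs))
    ≡⟨ ∑ℤ-sublists-∷ g x (filter P? xs) ⟨
  ∑ℤ g (sublists (x ∷ filter P? xs)) ∎
  where open ≡-Reasoning
... | no ¬px = trans (∑ℤ-sublists-∷ _ x xs)
  (trans (cong₂ _+_ (∑ℤ-sublists-filter P? g xs)
                    (∑ℤ-zero _ (λ E → cong (λ z → + z * g (x ∷ E)) (𝟙-no (All.all? P? (x ∷ E)) (λ all → ¬px (All.head all))))
                             (sublists xs)))
         (ℤ.+-identityʳ _))

∑ℤ-sublists-vanish : ∀ {A : Set} {P : A → Set} (g : List A → ℤ) → (∀ E → All P E → g E ≡ + 0) →
  ∀ xs → All P xs → ∑ℤ g (sublists xs) ≡ + 0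
∑ℤ-sublists-vanish g g≡0 [] [] = cong (_+ + 0) (g≡0 [] [])
∑ℤ-sublists-vanish g g≡0 (x ∷ xs) (px ∷ pxs) = trans (∑ℤ-sublists-∷ g x xs)
  (cong₂ _+_ (∑ℤ-sublists-vanish g g≡0 xs pxs)
             (∑ℤ-sublists-vanish (λ E → g (x ∷ E)) (λ E pE → g≡0 (x ∷ E) (px ∷ pE)) xs pxs))

incExc : ∀ {A : Set} → (List A → ℤ) → List A → ℤ
incExc h L = ∑ℤ (λ E → sign (length E) * h E) (sublists L)

incExc-cong : ∀ {A : Set} {h h′ : List A → ℤ} → (∀ E → h E ≡ h′ E) → ∀ L → incExc h L ≡ incExc h′ L
incExc-cong h≗h′ L = ∑ℤ-cong (λ E → cong (sign (length E) *_) (h≗h′ E)) (sublists L)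

incExc-∷ : ∀ {A : Set} (h : List A → ℤ) x L → incExc h (x ∷ L) ≡ incExc h L - incExc (λ E → h (x ∷ E)) L
incExc-∷ h x L = trans (∑ℤ-sublists-∷ _ x L)
  (cong (_+_ (incExc h L)) (trans (∑ℤ-cong (λ E → flip (sign (length E)) (h (x ∷ E))) (sublists L)) (∑ℤ-neg _ (sublists L))))
  where
  flip : ∀ s a → (-[1+ 0 ] * s) * a ≡ - (s * a)
  flip = solve-∀

incExc-map : ∀ {A B : Set} (h : List B → ℤ) (f : A → B) L → incExc h (map f L) ≡ incExc (λ E → h (map f E)) L
incExc-map h f L = trans (∑ℤ-sublists-map _ f L)
  (∑ℤ-cong (λ E → cong (λ m → sign m * h (map f E)) (List.length-map f E)) (sublists L))

whitney : ∀ k → List (Form k) → ℕ → ℤ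
whitney k L i = incExc (λ E → + 𝟙 (corank k E ℕ.+ i ℕ.≟ k)) L

corank-[] : ∀ k → corank k [] ≡ k
corank-[] zero = refl
corank-[] (suc k) = refl

coeff-whitney-[] : ∀ k i → + δ₀ i ≡ sign i * whitney k [] i
coeff-whitney-[] k zero =
  sym (cong (λ z → + 1 * (+ 1 * + z + + 0)) (𝟙-yes (corank k [] ℕ.+ 0 ℕ.≟ k) (trans (ℕ.+-identityʳ _) (corank-[] k))))
coeff-whitney-[] k (suc i) = sym (trans
  (cong (λ z → sign (suc i) * (+ 1 * + z + + 0))
        (𝟙-no (corank k [] ℕ.+ suc i ℕ.≟ k) (λ eq → ℕ.m+1+n≢m k (trans (cong (ℕ._+ suc i) (sym (corank-[] k))) eq))))
  (ℤ.*-zeroʳ (sign (suc i))))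

whitney-∷-zeroForm : ∀ {k} (ℓ : Form (suc k)) L i → ℓ ≡ zeroForm → whitney (suc k) (ℓ ∷ L) i ≡ + 0
whitney-∷-zeroForm {k} ℓ L i ℓ≡0 = begin
  whitney (suc k) (ℓ ∷ L) i
    ≡⟨ incExc-∷ _ ℓ L ⟩
  whitney (suc k) L i - incExc (λ E → + 𝟙 (corank⁺ k (ℓ ∷ E) ℕ.+ i ℕ.≟ suc k)) L
    ≡⟨ cong (_-_ (whitney (suc k) L i))
            (incExc-cong (λ E → cong (λ c → + 𝟙 (c ℕ.+ i ℕ.≟ suc k)) (corank⁺-zero ℓ E ℓ≡0)) L) ⟩
  whitney (suc k) L i - whitney (suc k) L i
    ≡⟨ ℤ.+-inverseʳ (whitney (suc k) L i) ⟩
  + 0 ∎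
  where open ≡-Reasoning

whitney-∷-pivot : ∀ {k} {ℓ : Form (suc k)} {p} L i → pivot? ℓ ≡ inj₁ p →
  whitney (suc k) (ℓ ∷ L) i ≡ whitney (suc k) L i - incExc (λ E → + 𝟙 (corank k E ℕ.+ i ℕ.≟ suc k)) (map (restrict p) L)
whitney-∷-pivot {k} {ℓ} {p} L i eq = trans (incExc-∷ _ ℓ L) (cong (_-_ (whitney (suc k) L i))
  (trans (incExc-cong (λ E → cong (λ c → + 𝟙 (c ℕ.+ i ℕ.≟ suc k)) (corank⁺-pivot E eq)) L)
         (sym (incExc-map (λ E → + 𝟙 (corank k E ℕ.+ i ℕ.≟ suc k)) (restrict p) L))))

incExc-corank≡suc : ∀ k (L : List (Form k)) → incExc (λ E → + 𝟙 (corank k E ℕ.+ 0 ℕ.≟ suc k)) L ≡ + 0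
incExc-corank≡suc k L = ∑ℤ-zero _ (λ E → trans (cong (λ z → sign (length E) * + z) (𝟙-no (corank k E ℕ.+ 0 ℕ.≟ suc k)
    (λ eq → ℕ.<-irrefl eq (s≤s (ℕ.≤-trans (ℕ.≤-reflexive (ℕ.+-identityʳ _)) (corank≤ k E))))))
  (ℤ.*-zeroʳ (sign (length E)))) (sublists L)

incExc-corank+suc : ∀ k (L : List (Form k)) j → incExc (λ E → + 𝟙 (corank k E ℕ.+ suc j ℕ.≟ suc k)) L ≡ whitney k L j
incExc-corank+suc k L j = incExc-cong (λ E → cong +_ (𝟙-cong (corank k E ℕ.+ suc j ℕ.≟ suc k) (corank k E ℕ.+ j ℕ.≟ k)
  (mk⇔ (λ eq → ℕ.suc-injective (trans (sym (ℕ.+-suc _ j)) eq)) (λ eq → trans (ℕ.+-suc _ j) (cong suc eq))))) L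

coeff-whitney : ∀ k (L : List (Form k)) i → + coeff k L i ≡ sign i * whitney k L i
coeff-whitney zero [] i = coeff-whitney-[] 0 i
coeff-whitney zero (ℓ ∷ L) i =
  sym (trans (cong (sign i *_) (trans (incExc-∷ _ ℓ L) (ℤ.+-inverseʳ (whitney 0 L i)))) (ℤ.*-zeroʳ (sign i)))
coeff-whitney (suc k) = go
  where
  go : ∀ L i → + coeff⁺ k L i ≡ sign i * whitney (suc k) L i
  go [] i = coeff-whitney-[] (suc k) i
  go (ℓ ∷ L) i with pivot? ℓ in eq
  ... | inj₂ ℓ≡0 = sym (trans (cong (sign i *_) (whitney-∷-zeroForm ℓ L i ℓ≡0)) (ℤ.*-zeroʳ (sign i)))
  ... | inj₁ p = split i
    where
    L′ = map (restrict p) L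
    split : ∀ i → + (coeff⁺ k L i ℕ.+ shift (coeff k L′) i) ≡ sign i * whitney (suc k) (ℓ ∷ L) i
    split zero = begin
      + (coeff⁺ k L 0 ℕ.+ 0)                ≡⟨ cong +_ (ℕ.+-identityʳ _) ⟩
      + coeff⁺ k L 0                         ≡⟨ go L 0 ⟩
      sign 0 * whitney (suc k) L 0           ≡⟨ cong (λ z → sign 0 * z) (ℤ.+-identityʳ _) ⟨
      sign 0 * (whitney (suc k) L 0 - + 0)   ≡⟨ cong (λ z → sign 0 * (whitney (suc k) L 0 - z)) (incExc-corank≡suc k L′) ⟨
      sign 0 * (whitney (suc k) L 0 - incExc (λ E → + 𝟙 (corank k E ℕ.+ 0 ℕ.≟ suc k)) L′)
                                             ≡⟨ cong (sign 0 *_) (whitney-∷-pivot L 0 eq) ⟨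
      sign 0 * whitney (suc k) (ℓ ∷ L) 0     ∎
      where open ≡-Reasoning
    split (suc j) = begin
      + (coeff⁺ k L (suc j) ℕ.+ coeff k L′ j)
        ≡⟨ ℤ.pos-+ (coeff⁺ k L (suc j)) (coeff k L′ j) ⟩
      + coeff⁺ k L (suc j) + + coeff k L′ j
        ≡⟨ cong₂ _+_ (go L (suc j)) (coeff-whitney k L′ j) ⟩
      sign (suc j) * whitney (suc k) L (suc j) + sign j * whitney k L′ j
        ≡⟨ signs (sign j) (whitney (suc k) L (suc j)) (whitney k L′ j) ⟩
      sign (suc j) * (whitney (suc k) L (suc j) - whitney k L′ j)
        ≡⟨ cong (λ z → sign (suc j) * (whitney (suc k) L (suc j) - z)) (incExc-corank+suc k L′ j) ⟨
      sign (suc j) * (whitney (suc k) L (suc j) - incExc (λ E → + 𝟙 (corank k E ℕ.+ suc j ℕ.≟ suc k)) L′)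
        ≡⟨ cong (sign (suc j) *_) (whitney-∷-pivot L (suc j) eq) ⟨
      sign (suc j) * whitney (suc k) (ℓ ∷ L) (suc j) ∎
      where
      open ≡-Reasoning
      signs : ∀ s a b → (-[1+ 0 ] * s) * a + s * b ≡ (-[1+ 0 ] * s) * (a - b)
      signs = solve-∀

-- The SET-free arrangement

mono : ∀ {k} → Fin k → 𝔽 → Fin k → 𝔽
mono i c t = if does (t Fin.≟ i) then c else 0F

mono-same : ∀ {k} (i : Fin k) c → mono i c i ≡ c
mono-same i c = cong (λ b → if b then c else 0F) (dec-true (i Fin.≟ i) refl)

mono-diff : ∀ {k} {t i : Fin k} c → t ≢ i → mono i c t ≡ 0F
mono-diff {t = t} {i} c t≢i = cong (λ b → if b then c else 0F) (dec-false (t Fin.≟ i) t≢i)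

mono-punchIn : ∀ {k} (r : Fin (suc k)) (i t : Fin k) c → mono (punchIn r i) c (punchIn r t) ≡ mono i c t
mono-punchIn r i t c with t Fin.≟ i
... | yes refl = mono-same (punchIn r t) c
... | no t≢i = mono-diff c (λ eq → t≢i (Fin.punchIn-injective r t i eq))

mono-punchIn-r : ∀ {k} (r : Fin (suc k)) (i : Fin k) c → mono (punchIn r i) c r ≡ 0F
mono-punchIn-r r i c = mono-diff c (λ eq → Fin.punchInᵢ≢i r i (sym eq))

eval-tabulate-⊕ : ∀ {n k} (g h : Fin k → 𝔽) (xs : Vec (F3^ n) k) →
  eval (tabulate (λ t → g t ⊕ h t)) xs ≡ eval (tabulate g) xs +v eval (tabulate h) xs
eval-tabulate-⊕ g h [] = sym (+v-identityʳ 0v)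
eval-tabulate-⊕ g h (x ∷ xs) =
  trans (cong₂ _+v_ (·-distribʳ-⊕ (g Fin.zero) (h Fin.zero) x) (eval-tabulate-⊕ (λ t → g (Fin.suc t)) (λ t → h (Fin.suc t)) xs))
        (+v-interchange _ _ _ _)

eval-mono : ∀ {n k} (i : Fin k) c (xs : Vec (F3^ n) k) → eval (tabulate (mono i c)) xs ≡ c · lookup xs i
eval-mono Fin.zero c (x ∷ xs) =
  trans (cong (c · x +v_) (eval-tabulate-zero _ xs (λ _ → refl))) (+v-identityʳ (c · x))
eval-mono (Fin.suc i) c (x ∷ xs) =
  trans (cong₂ _+v_ (·-zeroˡ x) (eval-mono i c xs)) (+v-identityˡ (c · lookup xs i))

-- The forms x_i − x_j (written x_i + 2 x_j) and x_i + x_j + x_l.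
diffForm : ∀ {k} → Fin k → Fin k → Form k
diffForm i j = tabulate (λ t → mono i 1F t ⊕ mono j 2F t)

sumForm : ∀ {k} → Fin k → Fin k → Fin k → Form k
sumForm i j l = tabulate (λ t → mono i 1F t ⊕ (mono j 1F t ⊕ mono l 1F t))

lookup-diffForm : ∀ {k} (i j t : Fin k) → lookup (diffForm i j) t ≡ mono i 1F t ⊕ mono j 2F t
lookup-diffForm i j t = Vec.lookup∘tabulate _ t

lookup-sumForm : ∀ {k} (i j l t : Fin k) → lookup (sumForm i j l) t ≡ mono i 1F t ⊕ (mono j 1F t ⊕ mono l 1F t)
lookup-sumForm i j l t = Vec.lookup∘tabulate _ t

eval-diffForm : ∀ {n k} (i j : Fin k) (xs : Vec (F3^ n) k) → eval (diffForm i j) xs ≡ 1F · lookup xs i +v 2F · lookup xs j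
eval-diffForm i j xs = trans (eval-tabulate-⊕ (mono i 1F) (mono j 2F) xs) (cong₂ _+v_ (eval-mono i 1F xs) (eval-mono j 2F xs))

eval-sumForm : ∀ {n k} (i j l : Fin k) (xs : Vec (F3^ n) k) →
  eval (sumForm i j l) xs ≡ (lookup xs i +v lookup xs j) +v lookup xs l
eval-sumForm i j l xs = begin
  eval (sumForm i j l) xs
    ≡⟨ eval-tabulate-⊕ (mono i 1F) (λ t → mono j 1F t ⊕ mono l 1F t) xs ⟩
  eval (tabulate (mono i 1F)) xs +v eval (tabulate (λ t → mono j 1F t ⊕ mono l 1F t)) xs
    ≡⟨ cong (eval (tabulate (mono i 1F)) xs +v_) (eval-tabulate-⊕ (mono j 1F) (mono l 1F) xs) ⟩
  eval (tabulate (mono i 1F)) xs +v (eval (tabulate (mono j 1F)) xs +v eval (tabulate (mono l 1F)) xs)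
    ≡⟨ cong₂ (λ a b → a +v (b +v _)) (trans (eval-mono i 1F xs) (·-identityˡ _)) (trans (eval-mono j 1F xs) (·-identityˡ _)) ⟩
  lookup xs i +v (lookup xs j +v eval (tabulate (mono l 1F)) xs)
    ≡⟨ cong (λ a → lookup xs i +v (lookup xs j +v a)) (trans (eval-mono l 1F xs) (·-identityˡ _)) ⟩
  lookup xs i +v (lookup xs j +v lookup xs l)
    ≡⟨ +v-assoc (lookup xs i) (lookup xs j) (lookup xs l) ⟨
  (lookup xs i +v lookup xs j) +v lookup xs l ∎
  where open ≡-Reasoning

eval-diffForm≡0⇔ : ∀ {n k} (i j : Fin k) (xs : Vec (F3^ n) k) → (eval (diffForm i j) xs ≡ 0v) ⇔ (lookup xs i ≡ lookup xs j)
eval-diffForm≡0⇔ i j xs = mk⇔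
  (λ eq → trans (Equivalence.to root (trans (sym (eval-diffForm i j xs)) eq)) (trans (·-assoc 2F 2F y) (·-identityˡ y)))
  (λ eq → trans (eval-diffForm i j xs) (trans (cong (λ z → 1F · z +v 2F · y) eq) (trans (sym (·-distribʳ-⊕ 1F 2F y)) (·-zeroˡ y))))
  where
  y = lookup xs j
  root = a·x+e≡0⇔x≡⊖a·e 1F (lookup xs i) (2F · y) (λ ())

unless : ∀ {p} {P : Set p} {A : Set} → Dec P → A → List A
unless d x = if does d then [] else x ∷ []

All-unless : ∀ {p q} {P : Set p} {A : Set} {Q : A → Set q} (d : Dec P) x → (¬ P → Q x) → All Q (unless d x)
All-unless (yes _) x _ = []
All-unless (no ¬p) x q = q ¬p ∷ []

unless⁻ : ∀ {p q} {P : Set p} {A : Set} {Q : A → Set q} (d : Dec P) x → ¬ P → All Q (unless d x) → Q x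
unless⁻ (yes p) x ¬p _ = ⊥-elim (¬p p)
unless⁻ (no _) x _ (qx ∷ []) = qx

concatTab : ∀ {k} {A : Set} → (Fin k → List A) → List A
concatTab h = List.concat (List.tabulate h)

All-concatTab : ∀ {k q} {A : Set} {Q : A → Set q} (h : Fin k → List A) → (∀ i → All Q (h i)) → All Q (concatTab h)
All-concatTab h all = Allₚ.concat⁺ (Allₚ.tabulate⁺ all)

concatTab⁻ : ∀ {k q} {A : Set} {Q : A → Set q} (h : Fin k → List A) → All Q (concatTab h) → ∀ i → All Q (h i)
concatTab⁻ h all = Allₚ.tabulate⁻ (Allₚ.concat⁻ all)

pairForm : ∀ {k} → Fin k → Fin k → List (Form k)
pairForm i j = unless (i Fin.≟ j) (diffForm i j)

tripleForm : ∀ {k} → Fin k → Fin k → Fin k → List (Form k)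
tripleForm i j l = unless (i Fin.≟ j ⊎-dec j Fin.≟ l ⊎-dec i Fin.≟ l) (sumForm i j l)

pairForms : ∀ k → List (Form k)
pairForms k = concatTab λ i → concatTab λ j → pairForm i j

tripleForms : ∀ k → List (Form k)
tripleForms k = concatTab λ i → concatTab λ j → concatTab λ l → tripleForm i j l

arrangement : ∀ k → List (Form k)
arrangement k = pairForms k ++ tripleForms k

SetFreeTuple⇔avoidsAll : ∀ {n k} (xs : Vec (F3^ n) k) →
  SetFreeTuple xs ⇔ All (λ ℓ → eval ℓ xs ≢ 0v) (arrangement k)
SetFreeTuple⇔avoidsAll {k = k} xs = mk⇔ to from
  where
  to : SetFreeTuple xs → All (λ ℓ → eval ℓ xs ≢ 0v) (arrangement k)
  to (distinct , noSet) = Allₚ.++⁺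
    (All-concatTab _ λ i → All-concatTab _ λ j → All-unless (i Fin.≟ j) (diffForm i j) λ i≢j eq →
      distinct i j i≢j (Equivalence.to (eval-diffForm≡0⇔ i j xs) eq))
    (All-concatTab _ λ i → All-concatTab _ λ j → All-concatTab _ λ l →
      All-unless (i Fin.≟ j ⊎-dec j Fin.≟ l ⊎-dec i Fin.≟ l) (sumForm i j l) λ ¬coincide eq →
      noSet i j l (¬coincide ∘ inj₁) (¬coincide ∘ inj₂ ∘ inj₁) (¬coincide ∘ inj₂ ∘ inj₂) (trans (sym (eval-sumForm i j l xs)) eq))
  from : All (λ ℓ → eval ℓ xs ≢ 0v) (arrangement k) → SetFreeTuple xs
  from all = distinct , noSet
    where
    distinct : Distinct xs
    distinct i j i≢j eq = unless⁻ (i Fin.≟ j) (diffForm i j) i≢j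
      (concatTab⁻ _ (concatTab⁻ _ (Allₚ.++⁻ˡ (pairForms k) all) i) j) (Equivalence.from (eval-diffForm≡0⇔ i j xs) eq)
    noSet : NoSet xs
    noSet i j l i≢j j≢l i≢l eq = unless⁻ (i Fin.≟ j ⊎-dec j Fin.≟ l ⊎-dec i Fin.≟ l) (sumForm i j l)
      [ i≢j , [ j≢l , i≢l ] ]
      (concatTab⁻ _ (concatTab⁻ _ (concatTab⁻ _ (Allₚ.++⁻ʳ (pairForms k) all) i) j) l) (trans (eval-sumForm i j l xs) eq)

avoids≡𝟙all : ∀ {n k} (L : List (Form k)) (xs : Vec (F3^ n) k) →
  avoids L xs ≡ 𝟙 (All.all? (λ ℓ → ¬? (eval ℓ xs ≟ 0v)) L)
avoids≡𝟙all [] xs = refl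
avoids≡𝟙all (ℓ ∷ L) xs = trans (cong (𝟙 (¬? (eval ℓ xs ≟ 0v)) ℕ.*_) (avoids≡𝟙all L xs))
  (sym (𝟙-×-dec (¬? (eval ℓ xs ≟ 0v)) (All.all? (λ ℓ → ¬? (eval ℓ xs ≟ 0v)) L)))

f≡count-avoids : ∀ n k → f n k ≡ ∑Points n k (avoids (arrangement k))
f≡count-avoids n k = begin
  f n k
    ≡⟨ length-filter setFreeTuple? (allTuples (allVecs n) k) ⟩
  ∑ (λ xs → 𝟙 (setFreeTuple? xs)) (allTuples (allVecs n) k)
    ≡⟨ ∑-allTuples k _ ⟩
  ∑Points n k (λ xs → 𝟙 (setFreeTuple? xs))
    ≡⟨ ∑Points-cong k (λ xs → trans (𝟙-cong (setFreeTuple? xs) (All.all? (λ ℓ → ¬? (eval ℓ xs ≟ 0v)) (arrangement k))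
                                                 (SetFreeTuple⇔avoidsAll xs)) (sym (avoids≡𝟙all (arrangement k) xs))) ⟩
  ∑Points n k (avoids (arrangement k)) ∎
  where open ≡-Reasoning

≢0At⇒≢zeroForm : ∀ {k} {ℓ : Form k} (i : Fin k) → lookup ℓ i ≢ 0F → ℓ ≢ zeroForm
≢0At⇒≢zeroForm {ℓ = ℓ} i ℓᵢ≢0 ℓ≡0 = ℓᵢ≢0 (trans (cong (λ m → lookup m i) ℓ≡0) (Vec.lookup∘tabulate _ i))

arrangement-nonzero : ∀ k → All (_≢ zeroForm) (arrangement k)
arrangement-nonzero k = Allₚ.++⁺
  (All-concatTab _ λ i → All-concatTab _ λ j → All-unless (i Fin.≟ j) (diffForm i j) λ i≢j →
    ≢0At⇒≢zeroForm i (λ eq → 1≢0 (trans (sym (diff[i]≡1 i≢j)) eq)))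
  (All-concatTab _ λ i → All-concatTab _ λ j → All-concatTab _ λ l →
    All-unless (i Fin.≟ j ⊎-dec j Fin.≟ l ⊎-dec i Fin.≟ l) (sumForm i j l) λ ¬coincide →
    ≢0At⇒≢zeroForm i (λ eq → 1≢0 (trans (sym (sum[i]≡1 (¬coincide ∘ inj₁) (¬coincide ∘ inj₂ ∘ inj₂))) eq)))
  where
  1≢0 : 1F ≢ 0F
  1≢0 ()
  diff[i]≡1 : ∀ {i j : Fin k} → i ≢ j → lookup (diffForm i j) i ≡ 1F
  diff[i]≡1 {i} {j} i≢j = trans (lookup-diffForm i j i) (cong₂ _⊕_ (mono-same i 1F) (mono-diff 2F i≢j))
  sum[i]≡1 : ∀ {i j l : Fin k} → i ≢ j → i ≢ l → lookup (sumForm i j l) i ≡ 1F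
  sum[i]≡1 {i} {j} {l} i≢j i≢l = trans (lookup-sumForm i j l i) (cong₂ _⊕_ (mono-same i 1F) (cong₂ _⊕_ (mono-diff 1F i≢j) (mono-diff 1F i≢l)))

-- Variables used by a sub-arrangement

∑-allFin-suc : ∀ {k} (g : Fin (suc k) → ℕ) → ∑ g (List.allFin (suc k)) ≡ g Fin.zero ℕ.+ ∑ (λ t → g (Fin.suc t)) (List.allFin k)
∑-allFin-suc {k} g = cong (g Fin.zero ℕ.+_)
  (trans (cong sum (List.map-tabulate Fin.suc g)) (sym (cong sum (List.map-tabulate id (λ t → g (Fin.suc t))))))

∑-allFin-delta : ∀ {k} (i : Fin k) → ∑ (λ t → 𝟙 (t Fin.≟ i)) (List.allFin k) ≡ 1
∑-allFin-delta {suc k} Fin.zero =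
  trans (∑-allFin-suc {k} (λ t → 𝟙 (t Fin.≟ Fin.zero)))
        (cong suc (∑-zero _ (λ t → 𝟙-no (Fin.suc t Fin.≟ Fin.zero) (λ ())) (List.allFin k)))
∑-allFin-delta {suc k} (Fin.suc i) = trans (∑-allFin-suc {k} (λ t → 𝟙 (t Fin.≟ Fin.suc i))) (∑-allFin-delta i)

∑-allFin-below : ∀ k j → j ≤ k → ∑ (λ t → 𝟙 (toℕ t ℕ.<? j)) (List.allFin k) ≡ j
∑-allFin-below k zero _ = ∑-zero _ (λ t → 𝟙-no (toℕ t ℕ.<? 0) (λ ())) (List.allFin k)
∑-allFin-below (suc k) (suc j) (s≤s j≤k) = trans (∑-allFin-suc {k} (λ t → 𝟙 (toℕ t ℕ.<? suc j)))
  (cong suc (trans (∑-cong (λ t → 𝟙-cong (suc (toℕ t) ℕ.<? suc j) (toℕ t ℕ.<? j) (mk⇔ ℕ.≤-pred s≤s)) (List.allFin k))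
                   (∑-allFin-below k j j≤k)))

-- Coefficients are indexed by ℕ (zero out of range) so that "x_p occurs" makes sense uniformly
-- in every number of variables.
coeffAt : ∀ {k} → Form k → ℕ → 𝔽
coeffAt [] p = 0F
coeffAt (a ∷ ℓ) zero = a
coeffAt (a ∷ ℓ) (suc p) = coeffAt ℓ p

coeffAt-toℕ : ∀ {k} (ℓ : Form k) (t : Fin k) → coeffAt ℓ (toℕ t) ≡ lookup ℓ t
coeffAt-toℕ (a ∷ ℓ) Fin.zero = refl
coeffAt-toℕ (a ∷ ℓ) (Fin.suc t) = coeffAt-toℕ ℓ t

coeffAt-out : ∀ {k} (ℓ : Form k) p → k ≤ p → coeffAt ℓ p ≡ 0F
coeffAt-out [] p _ = refl
coeffAt-out (a ∷ ℓ) (suc p) (s≤s k≤p) = coeffAt-out ℓ p k≤p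

Occurs : ∀ {k} → ℕ → Form k → Set
Occurs p ℓ = coeffAt ℓ p ≢ 0F

occurs? : ∀ {k} p (ℓ : Form k) → Dec (Occurs p ℓ)
occurs? p ℓ = ¬? (coeffAt ℓ p Fin.≟ 0F)

Uses : ∀ {k} → List (Form k) → ℕ → Set
Uses E p = Any (Occurs p) E

uses? : ∀ {k} (E : List (Form k)) p → Dec (Uses E p)
uses? E p = Any.any? (occurs? p) E

support : ∀ {k} → Form k → ℕ
support {k} ℓ = ∑ (λ t → 𝟙 (occurs? (toℕ t) ℓ)) (List.allFin k)

usedCount : ∀ k → List (Form k) → ℕ
usedCount k E = ∑ (λ t → 𝟙 (uses? E (toℕ t))) (List.allFin k)

UsesBelow : ∀ {k} → ℕ → List (Form k) → Set
UsesBelow zero E = ⊤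
UsesBelow (suc j) E = UsesBelow j E × Uses E j

usesBelow? : ∀ {k} j (E : List (Form k)) → Dec (UsesBelow j E)
usesBelow? zero E = yes tt
usesBelow? (suc j) E = usesBelow? j E ×-dec uses? E j

UsesBelow⇒Uses : ∀ {k} j (E : List (Form k)) → UsesBelow j E → ∀ p → p < j → Uses E p
UsesBelow⇒Uses (suc j) E (below , uses-j) p p<1+j with ℕ.m≤n⇒m<n∨m≡n (ℕ.≤-pred p<1+j)
... | inj₁ p<j = UsesBelow⇒Uses j E below p p<j
... | inj₂ refl = uses-j

UsesBelow⇒≤usedCount : ∀ k j (E : List (Form k)) → j ≤ k → UsesBelow j E → j ≤ usedCount k E
UsesBelow⇒≤usedCount k j E j≤k below = subst (_≤ usedCount k E) (∑-allFin-below k j j≤k)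
  (∑-mono (λ t → pointwise t (toℕ t ℕ.<? j)) (List.allFin k))
  where
  pointwise : ∀ t (d : Dec (toℕ t < j)) → 𝟙 d ≤ 𝟙 (uses? E (toℕ t))
  pointwise t (no _) = z≤n
  pointwise t (yes t<j) = ℕ.≤-reflexive (sym (𝟙-yes (uses? E (toℕ t)) (UsesBelow⇒Uses j E below (toℕ t) t<j)))

¬Uses⇒zeroAt : ∀ {k} (E : List (Form k)) (r : Fin k) → ¬ Uses E (toℕ r) → All (λ m → lookup m r ≡ 0F) E
¬Uses⇒zeroAt [] r _ = []
¬Uses⇒zeroAt (m ∷ E) r unused = m[r]≡0 ∷ ¬Uses⇒zeroAt E r (unused ∘ there)
  where
  m[r]≡0 : lookup m r ≡ 0F
  m[r]≡0 with lookup m r Fin.≟ 0F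
  ... | yes eq = eq
  ... | no ne = ⊥-elim (unused (here (λ eq → ne (trans (sym (coeffAt-toℕ m r)) eq))))

Fresh : ∀ {k} → Form k → List (Form k) → Set
Fresh {k} ℓ E = ∃ λ (t : Fin k) → Occurs (toℕ t) ℓ × ¬ Uses E (toℕ t)

fresh? : ∀ {k} (ℓ : Form k) E → Fresh ℓ E ⊎ (∀ p → Occurs p ℓ → Uses E p)
fresh? {k} ℓ E with Fin.any? (λ t → occurs? (toℕ t) ℓ ×-dec ¬? (uses? E (toℕ t)))
... | yes fresh = inj₁ fresh
... | no ¬fresh = inj₂ stale
  where
  stale : ∀ p → Occurs p ℓ → Uses E p
  stale p occ with p ℕ.<? k
  ... | no p≮k = ⊥-elim (occ (coeffAt-out ℓ p (ℕ.≮⇒≥ p≮k)))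
  ... | yes p<k with uses? E p
  ...   | yes used = used
  ...   | no unused = ⊥-elim (¬fresh (Fin.fromℕ< p<k , subst (λ q → Occurs q ℓ) (sym toℕp) occ
                                                    , subst (λ q → ¬ Uses E q) (sym toℕp) unused))
    where
    toℕp = Fin.toℕ-fromℕ< p<k

usedCount-[] : ∀ k → usedCount k [] ≡ 0
usedCount-[] k = ∑-zero _ (λ _ → refl) (List.allFin k)

usedCount-∷ : ∀ k (ℓ : Form k) E → usedCount k (ℓ ∷ E) ≤ usedCount k E ℕ.+ support ℓ
usedCount-∷ k ℓ E = ℕ.≤-trans (∑-mono (λ t → pointwise (toℕ t)) (List.allFin k))
  (ℕ.≤-reflexive (∑-+ (λ t → 𝟙 (uses? E (toℕ t))) (λ t → 𝟙 (occurs? (toℕ t) ℓ)) (List.allFin k)))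
  where
  bound : ∀ p (d : Dec (Uses (ℓ ∷ E) p)) → 𝟙 d ≤ 𝟙 (uses? E p) ℕ.+ 𝟙 (occurs? p ℓ)
  bound p (no _) = z≤n
  bound p (yes (here occ)) = ℕ.≤-trans (ℕ.≤-reflexive (sym (𝟙-yes (occurs? p ℓ) occ))) (ℕ.m≤n+m _ (𝟙 (uses? E p)))
  bound p (yes (there used)) = ℕ.≤-trans (ℕ.≤-reflexive (sym (𝟙-yes (uses? E p) used))) (ℕ.m≤m+n _ _)
  pointwise : ∀ p → 𝟙 (uses? (ℓ ∷ E) p) ≤ 𝟙 (uses? E p) ℕ.+ 𝟙 (occurs? p ℓ)
  pointwise p = bound p (uses? (ℓ ∷ E) p)

usedCount-stale : ∀ k (ℓ : Form k) E → (∀ p → Occurs p ℓ → Uses E p) → usedCount k (ℓ ∷ E) ≡ usedCount k E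
usedCount-stale k ℓ E stale = ∑-cong (λ t → 𝟙-cong (uses? (ℓ ∷ E) (toℕ t)) (uses? E (toℕ t))
  (mk⇔ (λ { (here occ) → stale (toℕ t) occ ; (there used) → used }) there)) (List.allFin k)

-- Each fresh variable costs one rank and a form of support ≤ 3 brings at most 3 new variables.
usedCount≤3*rank : ∀ k (E : List (Form k)) → All (λ ℓ → support ℓ ≤ 3) E → usedCount k E ≤ 3 ℕ.* (k ∸ corank k E)
usedCount≤3*rank k [] [] = ℕ.≤-trans (ℕ.≤-reflexive (usedCount-[] k)) z≤n
usedCount≤3*rank k (ℓ ∷ E) (ℓ≤3 ∷ E≤3) with fresh? ℓ E
... | inj₂ stale = begin
  usedCount k (ℓ ∷ E)               ≡⟨ usedCount-stale k ℓ E stale ⟩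
  usedCount k E                     ≤⟨ usedCount≤3*rank k E E≤3 ⟩
  3 ℕ.* (k ∸ corank k E)            ≤⟨ ℕ.*-monoʳ-≤ 3 (ℕ.∸-monoʳ-≤ k (corank-∷-≤ k ℓ E)) ⟩
  3 ℕ.* (k ∸ corank k (ℓ ∷ E))      ∎
  where open ℕ.≤-Reasoning
... | inj₁ (t , occ , unused) = fresh t ℓ E occ unused (usedCount≤3*rank k E E≤3) ℓ≤3
  where
  fresh : ∀ {k} (t : Fin k) ℓ E → Occurs (toℕ t) ℓ → ¬ Uses E (toℕ t) → usedCount k E ≤ 3 ℕ.* (k ∸ corank k E) →
          support ℓ ≤ 3 → usedCount k (ℓ ∷ E) ≤ 3 ℕ.* (k ∸ corank k (ℓ ∷ E))
  fresh {suc k} t ℓ E occ unused IH ℓ≤3 = begin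
    usedCount (suc k) (ℓ ∷ E)                         ≤⟨ usedCount-∷ (suc k) ℓ E ⟩
    usedCount (suc k) E ℕ.+ support ℓ                 ≤⟨ ℕ.+-mono-≤ IH ℓ≤3 ⟩
    3 ℕ.* (suc k ∸ corank (suc k) E) ℕ.+ 3            ≡⟨ cong (λ c → 3 ℕ.* (suc k ∸ c) ℕ.+ 3) (sym rank↑) ⟩
    3 ℕ.* (suc k ∸ suc c′) ℕ.+ 3                      ≡⟨ trans (ℕ.+-comm (3 ℕ.* (suc k ∸ suc c′)) 3) (sym (ℕ.*-suc 3 (suc k ∸ suc c′))) ⟩
    3 ℕ.* suc (suc k ∸ suc c′)                        ≡⟨ cong (3 ℕ.*_) (∸-suc c′ (suc k) c′<1+k) ⟨
    3 ℕ.* (suc k ∸ c′)                                ∎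
    where
    open ℕ.≤-Reasoning
    c′ = corank (suc k) (ℓ ∷ E)
    rank↑ : suc c′ ≡ corank (suc k) E
    rank↑ = corank-fresh t ℓ E (λ eq → occ (trans (coeffAt-toℕ ℓ t) eq)) (¬Uses⇒zeroAt E t unused)
    c′<1+k : suc c′ ≤ suc k
    c′<1+k = subst (_≤ suc k) (sym rank↑) (corank≤ (suc k) E)
    ∸-suc : ∀ c k → suc c ≤ k → k ∸ c ≡ suc (k ∸ suc c)
    ∸-suc zero (suc k) _ = refl
    ∸-suc (suc c) (suc k) (s≤s c<k) = ∸-suc c k c<k

support≤3 : ∀ {k} (ℓ : Form k) (i j l : Fin k) → (∀ t → lookup ℓ t ≢ 0F → t ≡ i ⊎ t ≡ j ⊎ t ≡ l) → support ℓ ≤ 3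
support≤3 {k} ℓ i j l within = begin
  support ℓ
    ≤⟨ ∑-mono pointwise (List.allFin k) ⟩
  ∑ (λ t → 𝟙 (t Fin.≟ i) ℕ.+ (𝟙 (t Fin.≟ j) ℕ.+ 𝟙 (t Fin.≟ l))) (List.allFin k)
    ≡⟨ ∑-+ (λ t → 𝟙 (t Fin.≟ i)) _ (List.allFin k) ⟩
  ∑ (λ t → 𝟙 (t Fin.≟ i)) (List.allFin k) ℕ.+ ∑ (λ t → 𝟙 (t Fin.≟ j) ℕ.+ 𝟙 (t Fin.≟ l)) (List.allFin k)
    ≡⟨ cong₂ ℕ._+_ (∑-allFin-delta i) (∑-+ (λ t → 𝟙 (t Fin.≟ j)) (λ t → 𝟙 (t Fin.≟ l)) (List.allFin k)) ⟩
  1 ℕ.+ (∑ (λ t → 𝟙 (t Fin.≟ j)) (List.allFin k) ℕ.+ ∑ (λ t → 𝟙 (t Fin.≟ l)) (List.allFin k))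
    ≡⟨ cong₂ (λ a b → 1 ℕ.+ (a ℕ.+ b)) (∑-allFin-delta j) (∑-allFin-delta l) ⟩
  3 ∎
  where
  open ℕ.≤-Reasoning
  hit : ∀ t → 1 ≤ 𝟙 (t Fin.≟ t)
  hit t = ℕ.≤-reflexive (sym (𝟙-yes (t Fin.≟ t) refl))
  bound : ∀ t (d : Dec (Occurs (toℕ t) ℓ)) → 𝟙 d ≤ 𝟙 (t Fin.≟ i) ℕ.+ (𝟙 (t Fin.≟ j) ℕ.+ 𝟙 (t Fin.≟ l))
  bound t (no _) = z≤n
  bound t (yes occ) with within t (λ eq → occ (trans (coeffAt-toℕ ℓ t) eq))
  ... | inj₁ refl = ℕ.≤-trans (hit t) (ℕ.m≤m+n _ _)
  ... | inj₂ (inj₁ refl) = ℕ.≤-trans (ℕ.≤-trans (hit t) (ℕ.m≤m+n _ (𝟙 (t Fin.≟ l)))) (ℕ.m≤n+m _ (𝟙 (t Fin.≟ i)))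
  ... | inj₂ (inj₂ refl) = ℕ.≤-trans (ℕ.≤-trans (hit t) (ℕ.m≤n+m _ (𝟙 (t Fin.≟ j)))) (ℕ.m≤n+m _ (𝟙 (t Fin.≟ i)))
  pointwise : ∀ t → 𝟙 (occurs? (toℕ t) ℓ) ≤ 𝟙 (t Fin.≟ i) ℕ.+ (𝟙 (t Fin.≟ j) ℕ.+ 𝟙 (t Fin.≟ l))
  pointwise t = bound t (occurs? (toℕ t) ℓ)

arrangement-support : ∀ k → All (λ ℓ → support ℓ ≤ 3) (arrangement k)
arrangement-support k = Allₚ.++⁺
  (All-concatTab _ λ i → All-concatTab _ λ j → All-unless (i Fin.≟ j) (diffForm i j) λ _ →
    support≤3 (diffForm i j) i j j (diff-within i j))
  (All-concatTab _ λ i → All-concatTab _ λ j → All-concatTab _ λ l →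
    All-unless (i Fin.≟ j ⊎-dec j Fin.≟ l ⊎-dec i Fin.≟ l) (sumForm i j l) λ _ →
    support≤3 (sumForm i j l) i j l (sum-within i j l))
  where
  diff-within : ∀ (i j t : Fin k) → lookup (diffForm i j) t ≢ 0F → t ≡ i ⊎ t ≡ j ⊎ t ≡ j
  diff-within i j t nz with t Fin.≟ i | t Fin.≟ j
  ... | yes t≡i | _ = inj₁ t≡i
  ... | no _ | yes t≡j = inj₂ (inj₁ t≡j)
  ... | no t≢i | no t≢j =
    ⊥-elim (nz (trans (lookup-diffForm i j t) (cong₂ _⊕_ (mono-diff 1F t≢i) (mono-diff 2F t≢j))))
  sum-within : ∀ (i j l t : Fin k) → lookup (sumForm i j l) t ≢ 0F → t ≡ i ⊎ t ≡ j ⊎ t ≡ l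
  sum-within i j l t nz with t Fin.≟ i | t Fin.≟ j | t Fin.≟ l
  ... | yes t≡i | _ | _ = inj₁ t≡i
  ... | no _ | yes t≡j | _ = inj₂ (inj₁ t≡j)
  ... | no _ | no _ | yes t≡l = inj₂ (inj₂ t≡l)
  ... | no t≢i | no t≢j | no t≢l = ⊥-elim (nz (trans (lookup-sumForm i j l t)
    (cong₂ _⊕_ (mono-diff 1F t≢i) (cong₂ _⊕_ (mono-diff 1F t≢j) (mono-diff 1F t≢l)))))

concatTab-cong : ∀ {k} {A : Set} {h h′ : Fin k → List A} → (∀ i → h i ≡ h′ i) → concatTab h ≡ concatTab h′
concatTab-cong h≗h′ = cong List.concat (List.tabulate-cong h≗h′)

concatTab-[] : ∀ {k} {A : Set} (h : Fin k → List A) → (∀ i → h i ≡ []) → concatTab h ≡ []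
concatTab-[] {zero} h _ = refl
concatTab-[] {suc k} h h≗[] =
  trans (cong (_++ concatTab (h ∘ Fin.suc)) (h≗[] Fin.zero)) (concatTab-[] (h ∘ Fin.suc) (h≗[] ∘ Fin.suc))

concatTab-punchIn : ∀ {k} {A : Set} (h : Fin (suc k) → List A) (r : Fin (suc k)) → h r ≡ [] →
  concatTab h ≡ concatTab (h ∘ punchIn r)
concatTab-punchIn h Fin.zero hr≡[] = cong (_++ concatTab (h ∘ Fin.suc)) hr≡[]
concatTab-punchIn {suc k} h (Fin.suc r) hr≡[] = cong (h Fin.zero ++_) (concatTab-punchIn (h ∘ Fin.suc) r hr≡[])

filter-concatTab : ∀ {k} {A : Set} {P : A → Set} (P? : ∀ x → Dec (P x)) (h : Fin k → List A) →
  filter P? (concatTab h) ≡ concatTab (filter P? ∘ h)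
filter-concatTab {zero} P? h = refl
filter-concatTab {suc k} P? h =
  trans (List.filter-++ P? (h Fin.zero) _) (cong (filter P? (h Fin.zero) ++_) (filter-concatTab P? (h ∘ Fin.suc)))

map-concatTab : ∀ {k} {A B : Set} (f : A → B) (h : Fin k → List A) → map f (concatTab h) ≡ concatTab (map f ∘ h)
map-concatTab f h = trans (sym (List.concat-map (List.tabulate h))) (cong List.concat (List.map-tabulate h (map f)))

filter-concatTab-[] : ∀ {k} {A : Set} {P : A → Set} (P? : ∀ x → Dec (P x)) (h : Fin k → List A) →
  (∀ i → filter P? (h i) ≡ []) → filter P? (concatTab h) ≡ []
filter-concatTab-[] P? h empty = trans (filter-concatTab P? h) (concatTab-[] _ empty)

filter-concatTab-punchIn : ∀ {k} {A B : Set} {P : A → Set} (P? : ∀ x → Dec (P x)) (f : B → A)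
  (h : Fin (suc k) → List A) (g : Fin k → List B) (r : Fin (suc k)) →
  filter P? (h r) ≡ [] → (∀ i → filter P? (h (punchIn r i)) ≡ map f (g i)) → filter P? (concatTab h) ≡ map f (concatTab g)
filter-concatTab-punchIn P? f h g r empty-r punched = begin
  filter P? (concatTab h)                  ≡⟨ filter-concatTab P? h ⟩
  concatTab (filter P? ∘ h)                ≡⟨ concatTab-punchIn (filter P? ∘ h) r empty-r ⟩
  concatTab (filter P? ∘ h ∘ punchIn r)    ≡⟨ concatTab-cong punched ⟩
  concatTab (map f ∘ g)                    ≡⟨ map-concatTab f g ⟨
  map f (concatTab g)                      ∎
  where open ≡-Reasoning

filter-unless-[] : ∀ {p} {P : Set p} {A : Set} {Z : A → Set} (Z? : ∀ x → Dec (Z x)) (d : Dec P) y →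
  (¬ P → ¬ Z y) → filter Z? (unless d y) ≡ []
filter-unless-[] Z? (yes _) y _ = refl
filter-unless-[] Z? (no ¬p) y ¬z with Z? y
... | yes z = ⊥-elim (¬z ¬p z)
... | no _ = refl

filter-unless-map : ∀ {p q} {P : Set p} {Q : Set q} {A B : Set} {Z : A → Set} (Z? : ∀ x → Dec (Z x)) (f : B → A)
  (d : Dec P) (e : Dec Q) y x → P ⇔ Q → Z y → y ≡ f x → filter Z? (unless d y) ≡ map f (unless e x)
filter-unless-map Z? f (yes _) (yes _) y x _ _ _ = refl
filter-unless-map Z? f (yes p) (no ¬q) y x P⇔Q _ _ = ⊥-elim (¬q (Equivalence.to P⇔Q p))
filter-unless-map Z? f (no ¬p) (yes q) y x P⇔Q _ _ = ⊥-elim (¬p (Equivalence.from P⇔Q q))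
filter-unless-map Z? f (no _) (no _) y x _ z refl with Z? (f x)
... | yes _ = refl
... | no ¬z = ⊥-elim (¬z z)

embed-tabulate : ∀ {k} (r : Fin (suc k)) (g : Fin k → 𝔽) (h : Fin (suc k) → 𝔽) →
  h r ≡ 0F → (∀ s → h (punchIn r s) ≡ g s) → embed r (tabulate g) ≡ tabulate h
embed-tabulate r g h hr≡0 h∘punchIn≗g = trans (sym (Vec.tabulate∘lookup (insertAt (tabulate g) r 0F))) (Vec.tabulate-cong pointwise)
  where
  pointwise : ∀ t → lookup (insertAt (tabulate g) r 0F) t ≡ h t
  pointwise t with r Fin.≟ t
  ... | yes refl = trans (Vec.insertAt-lookup (tabulate g) r 0F) (sym hr≡0)
  ... | no r≢t = begin
    lookup (insertAt (tabulate g) r 0F) t                      ≡⟨ cong (lookup (insertAt (tabulate g) r 0F)) (Fin.punchIn-punchOut r≢t) ⟨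
    lookup (insertAt (tabulate g) r 0F) (punchIn r (punchOut r≢t)) ≡⟨ Vec.insertAt-punchIn (tabulate g) r 0F (punchOut r≢t) ⟩
    lookup (tabulate g) (punchOut r≢t)                         ≡⟨ Vec.lookup∘tabulate g (punchOut r≢t) ⟩
    g (punchOut r≢t)                                           ≡⟨ h∘punchIn≗g (punchOut r≢t) ⟨
    h (punchIn r (punchOut r≢t))                               ≡⟨ cong h (Fin.punchIn-punchOut r≢t) ⟩
    h t                                                        ∎
    where open ≡-Reasoning

embed-diffForm : ∀ {k} (r : Fin (suc k)) (i j : Fin k) → embed r (diffForm i j) ≡ diffForm (punchIn r i) (punchIn r j)
embed-diffForm r i j = embed-tabulate r (λ t → mono i 1F t ⊕ mono j 2F t) (λ t → mono (punchIn r i) 1F t ⊕ mono (punchIn r j) 2F t)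
  (cong₂ _⊕_ (mono-punchIn-r r i 1F) (mono-punchIn-r r j 2F))
  (λ s → cong₂ _⊕_ (mono-punchIn r i s 1F) (mono-punchIn r j s 2F))

embed-sumForm : ∀ {k} (r : Fin (suc k)) (i j l : Fin k) →
  embed r (sumForm i j l) ≡ sumForm (punchIn r i) (punchIn r j) (punchIn r l)
embed-sumForm r i j l = embed-tabulate r (λ t → mono i 1F t ⊕ (mono j 1F t ⊕ mono l 1F t))
  (λ t → mono (punchIn r i) 1F t ⊕ (mono (punchIn r j) 1F t ⊕ mono (punchIn r l) 1F t))
  (cong₂ _⊕_ (mono-punchIn-r r i 1F) (cong₂ _⊕_ (mono-punchIn-r r j 1F) (mono-punchIn-r r l 1F)))
  (λ s → cong₂ _⊕_ (mono-punchIn r i s 1F) (cong₂ _⊕_ (mono-punchIn r j s 1F) (mono-punchIn r l s 1F)))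

zeroAt? : ∀ {k} (r : Fin k) (ℓ : Form k) → Dec (lookup ℓ r ≡ 0F)
zeroAt? r ℓ = lookup ℓ r Fin.≟ 0F

punchIn-≡⇔ : ∀ {k} (r : Fin (suc k)) (i j : Fin k) → (punchIn r i ≡ punchIn r j) ⇔ (i ≡ j)
punchIn-≡⇔ r i j = mk⇔ (Fin.punchIn-injective r i j) (cong (punchIn r))

-- Entries with an index equal to r involve x_r and are filtered out; the others are the forms
-- in the remaining k variables, embedded.
pairForms-restrict : ∀ {k} (r : Fin (suc k)) → filter (zeroAt? r) (pairForms (suc k)) ≡ map (embed r) (pairForms k)
pairForms-restrict {k} r = filter-concatTab-punchIn (zeroAt? r) (embed r) (λ i → concatTab (pairForm i)) (λ i → concatTab (pairForm i)) r
  (filter-concatTab-[] (zeroAt? r) (pairForm r) λ j → filter-unless-[] (zeroAt? r) (r Fin.≟ j) (diffForm r j) λ r≢j eq →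
    1≢0 (trans (sym (trans (lookup-diffForm r j r) (cong₂ _⊕_ (mono-same r 1F) (mono-diff 2F r≢j)))) eq))
  λ i → filter-concatTab-punchIn (zeroAt? r) (embed r) (pairForm (pI i)) (pairForm i) r
    (filter-unless-[] (zeroAt? r) (pI i Fin.≟ r) (diffForm (pI i) r) λ i≢r eq →
      2≢0 (trans (sym (trans (lookup-diffForm (pI i) r r) (cong₂ _⊕_ (mono-diff 1F (i≢r ∘ sym)) (mono-same r 2F)))) eq))
    λ j → filter-unless-map (zeroAt? r) (embed r) (pI i Fin.≟ pI j) (i Fin.≟ j) (diffForm (pI i) (pI j)) (diffForm i j)
      (punchIn-≡⇔ r i j)
      (trans (lookup-diffForm (pI i) (pI j) r) (cong₂ _⊕_ (mono-punchIn-r r i 1F) (mono-punchIn-r r j 2F)))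
      (sym (embed-diffForm r i j))
  where
  pI = punchIn r
  1≢0 : 1F ≢ 0F
  1≢0 ()
  2≢0 : 2F ≢ 0F
  2≢0 ()

tripleForms-restrict : ∀ {k} (r : Fin (suc k)) → filter (zeroAt? r) (tripleForms (suc k)) ≡ map (embed r) (tripleForms k)
tripleForms-restrict {k} r = filter-concatTab-punchIn (zeroAt? r) (embed r)
  (λ i → concatTab λ j → concatTab (tripleForm i j)) (λ i → concatTab λ j → concatTab (tripleForm i j)) r
  (filter-concatTab-[] (zeroAt? r) (λ j → concatTab (tripleForm r j)) λ j → filter-concatTab-[] (zeroAt? r) (tripleForm r j) λ l →
    filter-unless-[] (zeroAt? r) (r Fin.≟ j ⊎-dec j Fin.≟ l ⊎-dec r Fin.≟ l) (sumForm r j l) λ ¬coincide eq →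
      1≢0 (trans (sym (trans (lookup-sumForm r j l r) (cong₂ _⊕_ (mono-same r 1F)
        (cong₂ _⊕_ (mono-diff 1F (¬coincide ∘ inj₁)) (mono-diff 1F (¬coincide ∘ inj₂ ∘ inj₂)))))) eq))
  λ i → filter-concatTab-punchIn (zeroAt? r) (embed r) (λ j → concatTab (tripleForm (pI i) j)) (λ j → concatTab (tripleForm i j)) r
    (filter-concatTab-[] (zeroAt? r) (tripleForm (pI i) r) λ l →
      filter-unless-[] (zeroAt? r) (pI i Fin.≟ r ⊎-dec r Fin.≟ l ⊎-dec pI i Fin.≟ l) (sumForm (pI i) r l) λ ¬coincide eq →
        1≢0 (trans (sym (trans (lookup-sumForm (pI i) r l r) (cong₂ _⊕_ (mono-diff 1F (¬coincide ∘ inj₁ ∘ sym))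
          (cong₂ _⊕_ (mono-same r 1F) (mono-diff 1F (¬coincide ∘ inj₂ ∘ inj₁)))))) eq))
    λ j → filter-concatTab-punchIn (zeroAt? r) (embed r) (tripleForm (pI i) (pI j)) (tripleForm i j) r
      (filter-unless-[] (zeroAt? r) (pI i Fin.≟ pI j ⊎-dec pI j Fin.≟ r ⊎-dec pI i Fin.≟ r) (sumForm (pI i) (pI j) r)
        λ ¬coincide eq → 1≢0 (trans (sym (trans (lookup-sumForm (pI i) (pI j) r r) (cong₂ _⊕_ (mono-diff 1F (¬coincide ∘ inj₂ ∘ inj₂ ∘ sym))
          (cong₂ _⊕_ (mono-diff 1F (¬coincide ∘ inj₂ ∘ inj₁ ∘ sym)) (mono-same r 1F))))) eq))
      λ l → filter-unless-map (zeroAt? r) (embed r)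
        (pI i Fin.≟ pI j ⊎-dec pI j Fin.≟ pI l ⊎-dec pI i Fin.≟ pI l) (i Fin.≟ j ⊎-dec j Fin.≟ l ⊎-dec i Fin.≟ l)
        (sumForm (pI i) (pI j) (pI l)) (sumForm i j l)
        (punchIn-≡⇔ r i j ⊎-⇔ punchIn-≡⇔ r j l ⊎-⇔ punchIn-≡⇔ r i l)
        (trans (lookup-sumForm (pI i) (pI j) (pI l) r)
               (cong₂ _⊕_ (mono-punchIn-r r i 1F) (cong₂ _⊕_ (mono-punchIn-r r j 1F) (mono-punchIn-r r l 1F))))
        (sym (embed-sumForm r i j l))
  where
  pI = punchIn r
  1≢0 : 1F ≢ 0F
  1≢0 ()

arrangement-restrict : ∀ {k} (r : Fin (suc k)) → filter (zeroAt? r) (arrangement (suc k)) ≡ map (embed r) (arrangement k)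
arrangement-restrict {k} r = begin
  filter (zeroAt? r) (pairForms (suc k) ++ tripleForms (suc k))
    ≡⟨ List.filter-++ (zeroAt? r) (pairForms (suc k)) (tripleForms (suc k)) ⟩
  filter (zeroAt? r) (pairForms (suc k)) ++ filter (zeroAt? r) (tripleForms (suc k))
    ≡⟨ cong₂ _++_ (pairForms-restrict r) (tripleForms-restrict r) ⟩
  map (embed r) (pairForms k) ++ map (embed r) (tripleForms k)
    ≡⟨ List.map-++ (embed r) (pairForms k) (tripleForms k) ⟨
  map (embed r) (arrangement k) ∎
  where open ≡-Reasoning

-- Dependence on k

whitneyBelow : ∀ k → List (Form k) → ℕ → ℕ → ℤ
whitneyBelow k L j i = incExc (λ E → + 𝟙 (corank k E ℕ.+ i ℕ.≟ k) * + 𝟙 (usesBelow? j E)) L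

whitney≡whitneyBelow₀ : ∀ k L i → whitney k L i ≡ whitneyBelow k L 0 i
whitney≡whitneyBelow₀ k L i = incExc-cong (λ E → sym (ℤ.*-identityʳ _)) L

coeffAt-embed : ∀ {k} (ℓ : Form k) (r : Fin (suc k)) p → p < toℕ r → coeffAt (embed r ℓ) p ≡ coeffAt ℓ p
coeffAt-embed (a ∷ ℓ) (Fin.suc r) zero _ = refl
coeffAt-embed (a ∷ ℓ) (Fin.suc r) (suc p) (s≤s p<r) = coeffAt-embed ℓ r p p<r

Uses-embed : ∀ {k} (r : Fin (suc k)) (E : List (Form k)) p → p < toℕ r → Uses (map (embed r) E) p ⇔ Uses E p
Uses-embed r E p p<r = mk⇔ (to E) (from E)
  where
  to : ∀ E → Uses (map (embed r) E) p → Uses E p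
  to (ℓ ∷ E) (here occ) = here (λ eq → occ (trans (coeffAt-embed ℓ r p p<r) eq))
  to (ℓ ∷ E) (there used) = there (to E used)
  from : ∀ E → Uses E p → Uses (map (embed r) E) p
  from (ℓ ∷ E) (here occ) = here (λ eq → occ (trans (sym (coeffAt-embed ℓ r p p<r)) eq))
  from (ℓ ∷ E) (there used) = there (from E used)

UsesBelow-embed : ∀ {k} (r : Fin (suc k)) (E : List (Form k)) j → j ≤ toℕ r → UsesBelow j (map (embed r) E) ⇔ UsesBelow j E
UsesBelow-embed r E zero _ = mk⇔ (λ _ → tt) (λ _ → tt)
UsesBelow-embed r E (suc j) j<r = mk⇔
  (λ { (below , used) → Equivalence.to (UsesBelow-embed r E j (ℕ.<⇒≤ j<r)) below , Equivalence.to (Uses-embed r E j j<r) used })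
  (λ { (below , used) → Equivalence.from (UsesBelow-embed r E j (ℕ.<⇒≤ j<r)) below , Equivalence.from (Uses-embed r E j j<r) used })

zeroAt⇒¬Uses : ∀ {k} (E : List (Form k)) (r : Fin k) → All (λ m → lookup m r ≡ 0F) E → ¬ Uses E (toℕ r)
zeroAt⇒¬Uses (m ∷ E) r (m[r]≡0 ∷ _) (here occ) = occ (trans (coeffAt-toℕ m r) m[r]≡0)
zeroAt⇒¬Uses (m ∷ E) r (_ ∷ E[r]≡0) (there used) = zeroAt⇒¬Uses E r E[r]≡0 used

usesBelow-split : ∀ {k} (r : Fin k) (E : List (Form k)) →
  𝟙 (usesBelow? (toℕ r) E) ≡ 𝟙 (usesBelow? (suc (toℕ r)) E) ℕ.+ 𝟙 (usesBelow? (toℕ r) E) ℕ.* 𝟙 (All.all? (zeroAt? r) E)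
usesBelow-split r E = split (usesBelow? (toℕ r) E) (uses? E (toℕ r)) (All.all? (zeroAt? r) E)
  where
  split : (b : Dec (UsesBelow (toℕ r) E)) (u : Dec (Uses E (toℕ r))) (z : Dec (All (λ m → lookup m r ≡ 0F) E)) →
          𝟙 b ≡ 𝟙 (b ×-dec u) ℕ.+ 𝟙 b ℕ.* 𝟙 z
  split (no _) _ _ = refl
  split (yes _) (yes _) (no _) = refl
  split (yes _) (no _) (yes _) = refl
  split (yes _) (yes used) (yes E[r]≡0) = ⊥-elim (zeroAt⇒¬Uses E r E[r]≡0 used)
  split (yes _) (no unused) (no nonzero) = ⊥-elim (nonzero (¬Uses⇒zeroAt E r unused))

whitneyBelow-restrict : ∀ k (r : Fin (suc k)) i →
  incExc (λ E → + 𝟙 (corank (suc k) E ℕ.+ i ℕ.≟ suc k) * + 𝟙 (usesBelow? (toℕ r) E)) (filter (zeroAt? r) (arrangement (suc k)))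
    ≡ whitneyBelow k (arrangement k) (toℕ r) i
whitneyBelow-restrict k r i = begin
  incExc h (filter (zeroAt? r) (arrangement (suc k)))
    ≡⟨ cong (incExc h) (arrangement-restrict r) ⟩
  incExc h (map (embed r) (arrangement k))
    ≡⟨ incExc-map h (embed r) (arrangement k) ⟩
  incExc (λ E → h (map (embed r) E)) (arrangement k)
    ≡⟨ incExc-cong (λ E → cong₂ _*_ (rank-embed E) (below-embed E)) (arrangement k) ⟩
  whitneyBelow k (arrangement k) (toℕ r) i ∎
  where
  open ≡-Reasoning
  h : List (Form (suc k)) → ℤ
  h E = + 𝟙 (corank (suc k) E ℕ.+ i ℕ.≟ suc k) * + 𝟙 (usesBelow? (toℕ r) E)
  rank-embed : ∀ E → + 𝟙 (corank (suc k) (map (embed r) E) ℕ.+ i ℕ.≟ suc k) ≡ + 𝟙 (corank k E ℕ.+ i ℕ.≟ k)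
  rank-embed E = cong +_ (trans (cong (λ c → 𝟙 (c ℕ.+ i ℕ.≟ suc k)) (corank-embed k r E))
    (𝟙-cong (suc (corank k E) ℕ.+ i ℕ.≟ suc k) (corank k E ℕ.+ i ℕ.≟ k) (mk⇔ ℕ.suc-injective (cong suc))))
  below-embed : ∀ E → + 𝟙 (usesBelow? (toℕ r) (map (embed r) E)) ≡ + 𝟙 (usesBelow? (toℕ r) E)
  below-embed E = cong +_ (𝟙-cong (usesBelow? (toℕ r) (map (embed r) E)) (usesBelow? (toℕ r) E)
                                  (UsesBelow-embed r E (toℕ r) ℕ.≤-refl))

whitneyBelow-step : ∀ k (r : Fin (suc k)) i →
  whitneyBelow (suc k) (arrangement (suc k)) (toℕ r) i
    ≡ whitneyBelow (suc k) (arrangement (suc k)) (suc (toℕ r)) i + whitneyBelow k (arrangement k) (toℕ r) i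
whitneyBelow-step k r i = begin
  whitneyBelow (suc k) A j i
    ≡⟨ ∑ℤ-cong split (sublists A) ⟩
  ∑ℤ (λ E → s E * (rank E * below (suc j) E) + zeroAt E * (s E * (rank E * below j E))) (sublists A)
    ≡⟨ ∑ℤ-+ _ _ (sublists A) ⟩
  whitneyBelow (suc k) A (suc j) i + ∑ℤ (λ E → zeroAt E * (s E * (rank E * below j E))) (sublists A)
    ≡⟨ cong (_+_ (whitneyBelow (suc k) A (suc j) i))
            (trans (∑ℤ-sublists-filter (zeroAt? r) (λ E → s E * (rank E * below j E)) A) (whitneyBelow-restrict k r i)) ⟩
  whitneyBelow (suc k) A (suc j) i + whitneyBelow k (arrangement k) j i ∎
  where
  open ≡-Reasoning
  A = arrangement (suc k)
  j = toℕ r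
  s : List (Form (suc k)) → ℤ
  s E = sign (length E)
  rank : List (Form (suc k)) → ℤ
  rank E = + 𝟙 (corank (suc k) E ℕ.+ i ℕ.≟ suc k)
  below : ℕ → List (Form (suc k)) → ℤ
  below j E = + 𝟙 (usesBelow? j E)
  zeroAt : List (Form (suc k)) → ℤ
  zeroAt E = + 𝟙 (All.all? (zeroAt? r) E)
  split : ∀ E → s E * (rank E * below j E) ≡ s E * (rank E * below (suc j) E) + zeroAt E * (s E * (rank E * below j E))
  split E = trans (cong (λ z → s E * (rank E * z))
                        (trans (cong +_ (usesBelow-split r E))
                          (trans (ℤ.pos-+ (𝟙 (usesBelow? (suc j) E)) _)
                                 (cong (_+_ (below (suc j) E)) (ℤ.pos-* (𝟙 (usesBelow? j E)) (𝟙 (All.all? (zeroAt? r) E)))))))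
                  (distrib (s E) (rank E) (below (suc j) E) (below j E) (zeroAt E))
    where
    distrib : ∀ s c b b′ z → s * (c * (b + b′ * z)) ≡ s * (c * b) + z * (s * (c * b′))
    distrib = solve-∀

-- A sub-arrangement using j variables has rank ≥ j/3, while rank i means corank k - i.
whitneyBelow-vanish : ∀ k j i → j ≤ k → 3 ℕ.* i < j → whitneyBelow k (arrangement k) j i ≡ + 0
whitneyBelow-vanish k j i j≤k 3i<j = ∑ℤ-sublists-vanish _ term (arrangement k) (arrangement-support k)
  where
  term : ∀ E → All (λ ℓ → support ℓ ≤ 3) E →
    sign (length E) * (+ 𝟙 (corank k E ℕ.+ i ℕ.≟ k) * + 𝟙 (usesBelow? j E)) ≡ + 0
  term E E≤3 with usesBelow? j E
  ... | no _ = trans (cong (sign (length E) *_) (ℤ.*-zeroʳ (+ 𝟙 (corank k E ℕ.+ i ℕ.≟ k)))) (ℤ.*-zeroʳ (sign (length E)))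
  ... | yes below = trans (cong (λ z → sign (length E) * (+ z * + 1)) (𝟙-no (corank k E ℕ.+ i ℕ.≟ k) rank≢i))
                          (ℤ.*-zeroʳ (sign (length E)))
    where
    rank≢i : corank k E ℕ.+ i ≢ k
    rank≢i eq = ℕ.<-irrefl (sym (trans (cong (ℕ._∸ corank k E) (sym eq)) (ℕ.m+n∸m≡n (corank k E) i)))
      (ℕ.*-cancelˡ-< 3 i (k ∸ corank k E)
        (ℕ.<-≤-trans 3i<j (ℕ.≤-trans (UsesBelow⇒≤usedCount k j E j≤k below) (usedCount≤3*rank k E E≤3))))

-- forwardDiff i j is the j-th forward difference of k ↦ c_i(k), cf. forwardDiff-step.
forwardDiff : ℕ → ℕ → ℕ → ℤ
forwardDiff i j k = sign i * whitneyBelow (j ℕ.+ k) (arrangement (j ℕ.+ k)) j i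

forwardDiff-step : ∀ i j k → forwardDiff i j (suc k) ≡ forwardDiff i (suc j) k + forwardDiff i j k
forwardDiff-step i j k = begin
  sign i * whitneyBelow (j ℕ.+ suc k) (arrangement (j ℕ.+ suc k)) j i
    ≡⟨ cong (λ K → sign i * whitneyBelow K (arrangement K) j i) (ℕ.+-suc j k) ⟩
  sign i * whitneyBelow (suc (j ℕ.+ k)) (arrangement (suc (j ℕ.+ k))) j i
    ≡⟨ cong (λ z → sign i * whitneyBelow (suc (j ℕ.+ k)) (arrangement (suc (j ℕ.+ k))) z i) (sym toℕr≡j) ⟩
  sign i * whitneyBelow (suc (j ℕ.+ k)) (arrangement (suc (j ℕ.+ k))) (toℕ r) i
    ≡⟨ cong (sign i *_) (whitneyBelow-step (j ℕ.+ k) r i) ⟩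
  sign i * (whitneyBelow (suc (j ℕ.+ k)) (arrangement (suc (j ℕ.+ k))) (suc (toℕ r)) i
              + whitneyBelow (j ℕ.+ k) (arrangement (j ℕ.+ k)) (toℕ r) i)
    ≡⟨ cong (λ z → sign i * (whitneyBelow (suc (j ℕ.+ k)) (arrangement (suc (j ℕ.+ k))) (suc z) i
                              + whitneyBelow (j ℕ.+ k) (arrangement (j ℕ.+ k)) z i)) toℕr≡j ⟩
  sign i * (whitneyBelow (suc j ℕ.+ k) (arrangement (suc j ℕ.+ k)) (suc j) i
              + whitneyBelow (j ℕ.+ k) (arrangement (j ℕ.+ k)) j i)
    ≡⟨ ℤ.*-distribˡ-+ (sign i) _ _ ⟩
  forwardDiff i (suc j) k + forwardDiff i j k ∎
  where
  open ≡-Reasoning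
  r : Fin (suc (j ℕ.+ k))
  r = Fin.fromℕ< (s≤s (ℕ.m≤m+n j k))
  toℕr≡j : toℕ r ≡ j
  toℕr≡j = Fin.toℕ-fromℕ< (s≤s (ℕ.m≤m+n j k))

forwardDiff-vanish : ∀ i j k → 3 ℕ.* i < j → forwardDiff i j k ≡ + 0
forwardDiff-vanish i j k 3i<j =
  trans (cong (sign i *_) (whitneyBelow-vanish (j ℕ.+ k) j i (ℕ.m≤m+n j k) 3i<j)) (ℤ.*-zeroʳ (sign i))

sumℤ-first : ∀ N (g : ℕ → ℤ) → (∀ t → g (suc t) ≡ + 0) → sumℤ N g ≡ g 0
sumℤ-first zero g _ = refl
sumℤ-first (suc N) g g≗0 = trans (cong₂ _+_ (sumℤ-first N g g≗0) (g≗0 N)) (ℤ.+-identityʳ (g 0))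

sumℤ-truncate : ∀ D N (g : ℕ → ℤ) → D ≤ N → (∀ t → D < t → g t ≡ + 0) → sumℤ N g ≡ sumℤ D g
sumℤ-truncate D N g D≤N g≗0 with ℕ.m≤n⇒m<n∨m≡n D≤N
... | inj₂ refl = refl
sumℤ-truncate D (suc N) g _ g≗0 | inj₁ D<1+N =
  trans (cong₂ _+_ (sumℤ-truncate D N g (ℕ.≤-pred D<1+N) g≗0) (g≗0 (suc N) D<1+N)) (ℤ.+-identityʳ _)

newton : (d : ℕ → ℕ → ℤ) → (∀ j k → d j (suc k) ≡ d (suc j) k + d j k) →
  ∀ k j N → k ≤ N → d j k ≡ sumℤ N (λ t → + (k C t) * d (j ℕ.+ t) 0)
newton d step zero j N _ = sym (begin
  sumℤ N (λ t → + (0 C t) * d (j ℕ.+ t) 0)  ≡⟨ sumℤ-first N _ (λ t → ℤ.*-zeroˡ (d (j ℕ.+ suc t) 0)) ⟩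
  + 1 * d (j ℕ.+ 0) 0                       ≡⟨ ℤ.*-identityˡ _ ⟩
  d (j ℕ.+ 0) 0                             ≡⟨ cong (λ z → d z 0) (ℕ.+-identityʳ j) ⟩
  d j 0                                     ∎)
  where open ≡-Reasoning
newton d step (suc k) j (suc N) (s≤s k≤N) = begin
  d j (suc k)
    ≡⟨ step j k ⟩
  d (suc j) k + d j k
    ≡⟨ cong₂ _+_ (newton d step k (suc j) N k≤N) (newton d step k j (suc N) (ℕ.m≤n⇒m≤1+n k≤N)) ⟩
  sumℤ N (λ t → + (k C t) * d (suc j ℕ.+ t) 0) + sumℤ (suc N) (λ t → + (k C t) * d (j ℕ.+ t) 0)
    ≡⟨ cong (_+_ (sumℤ N (λ t → + (k C t) * d (suc j ℕ.+ t) 0))) (sumℤ-suc N _) ⟩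
  sumℤ N (λ t → + (k C t) * d (suc j ℕ.+ t) 0) + (d₀ + sumℤ N (λ t → + (k C suc t) * d (j ℕ.+ suc t) 0))
    ≡⟨ swap (sumℤ N (λ t → + (k C t) * d (suc j ℕ.+ t) 0)) d₀ _ ⟩
  d₀ + (sumℤ N (λ t → + (k C t) * d (suc j ℕ.+ t) 0) + sumℤ N (λ t → + (k C suc t) * d (j ℕ.+ suc t) 0))
    ≡⟨ cong (λ z → d₀ + (z + sumℤ N (λ t → + (k C suc t) * d (j ℕ.+ suc t) 0)))
            (sumℤ-cong N (λ t → cong (λ z → + (k C t) * d z 0) (sym (ℕ.+-suc j t)))) ⟩
  d₀ + (sumℤ N (λ t → + (k C t) * d (j ℕ.+ suc t) 0) + sumℤ N (λ t → + (k C suc t) * d (j ℕ.+ suc t) 0))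
    ≡⟨ cong (_+_ d₀) (sumℤ-+ N _ _) ⟨
  d₀ + sumℤ N (λ t → + (k C t) * d (j ℕ.+ suc t) 0 + + (k C suc t) * d (j ℕ.+ suc t) 0)
    ≡⟨ cong (_+_ d₀) (sumℤ-cong N (λ t → pascal t)) ⟩
  d₀ + sumℤ N (λ t → + (suc k C suc t) * d (j ℕ.+ suc t) 0)
    ≡⟨ sumℤ-suc N _ ⟨
  sumℤ (suc N) (λ t → + (suc k C t) * d (j ℕ.+ t) 0) ∎
  where
  open ≡-Reasoning
  d₀ = + 1 * d (j ℕ.+ 0) 0
  swap : ∀ a b c → a + (b + c) ≡ b + (a + c)
  swap = solve-∀
  pascal : ∀ t → + (k C t) * d (j ℕ.+ suc t) 0 + + (k C suc t) * d (j ℕ.+ suc t) 0 ≡ + (suc k C suc t) * d (j ℕ.+ suc t) 0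
  pascal t = trans (sym (ℤ.*-distribʳ-+ (d (j ℕ.+ suc t) 0) (+ (k C t)) (+ (k C suc t))))
                   (cong (λ z → z * d (j ℕ.+ suc t) 0) (trans (sym (ℤ.pos-+ (k C t) (k C suc t))) (cong +_ (nCk+nC[k+1]≡[n+1]C[k+1] k t))))

coeff-newton : ∀ i k → + coeff k (arrangement k) i ≡ sumℤ (3 ℕ.* i) (λ t → + (k C t) * forwardDiff i t 0)
coeff-newton i k = begin
  + coeff k (arrangement k) i
    ≡⟨ coeff-whitney k (arrangement k) i ⟩
  sign i * whitney k (arrangement k) i
    ≡⟨ cong (sign i *_) (whitney≡whitneyBelow₀ k (arrangement k) i) ⟩
  forwardDiff i 0 k
    ≡⟨ newton (forwardDiff i) (forwardDiff-step i) k 0 (k ℕ.⊔ 3 ℕ.* i) (ℕ.m≤m⊔n k _) ⟩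
  sumℤ (k ℕ.⊔ 3 ℕ.* i) (λ t → + (k C t) * forwardDiff i t 0)
    ≡⟨ sumℤ-truncate (3 ℕ.* i) (k ℕ.⊔ 3 ℕ.* i) _ (ℕ.m≤n⊔m k _)
         (λ t 3i<t → trans (cong (+ (k C t) *_) (forwardDiff-vanish i t 0 3i<t)) (ℤ.*-zeroʳ (+ (k C t)))) ⟩
  sumℤ (3 ℕ.* i) (λ t → + (k C t) * forwardDiff i t 0) ∎
  where open ≡-Reasoning

-- Polynomials in k

⟦_⟧ : ∀ {m} → Vec ℤ m → ℤ → ℤ
⟦ [] ⟧ x = + 0
⟦ a ∷ v ⟧ x = a + x * ⟦ v ⟧ x

Polynomial : ℕ → (ℤ → ℤ) → Set
Polynomial d f = Σ (Vec ℤ (suc d)) λ v → ∀ x → ⟦ v ⟧ x ≡ f x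

polynomial-const : ∀ d c → Polynomial d (λ _ → c)
polynomial-const d c = c ∷ replicate d (+ 0) , λ x →
  trans (cong (λ z → c + x * z) (zeros d x)) (trans (cong (_+_ c) (ℤ.*-zeroʳ x)) (ℤ.+-identityʳ c))
  where
  zeros : ∀ d x → ⟦ replicate d (+ 0) ⟧ x ≡ + 0
  zeros zero x = refl
  zeros (suc d) x = trans (cong (λ z → + 0 + x * z) (zeros d x)) (cong (_+_ (+ 0)) (ℤ.*-zeroʳ x))

polynomial-+ : ∀ {d f g} → Polynomial d f → Polynomial d g → Polynomial d (λ x → f x + g x)
polynomial-+ (v , ⟦v⟧≗f) (w , ⟦w⟧≗g) = zipWith _+_ v w , λ x → trans (⟦+⟧ v w x) (cong₂ _+_ (⟦v⟧≗f x) (⟦w⟧≗g x))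
  where
  ⟦+⟧ : ∀ {m} (v w : Vec ℤ m) x → ⟦ zipWith _+_ v w ⟧ x ≡ ⟦ v ⟧ x + ⟦ w ⟧ x
  ⟦+⟧ [] [] x = refl
  ⟦+⟧ (a ∷ v) (b ∷ w) x = trans (cong (λ z → a + b + x * z) (⟦+⟧ v w x)) (distrib a b x (⟦ v ⟧ x) (⟦ w ⟧ x))
    where
    distrib : ∀ a b x p q → a + b + x * (p + q) ≡ a + x * p + (b + x * q)
    distrib = solve-∀

polynomial-scale : ∀ {d f} c → Polynomial d f → Polynomial d (λ x → c * f x)
polynomial-scale c (v , ⟦v⟧≗f) = Vec.map (c *_) v , λ x → trans (⟦scale⟧ v x) (cong (c *_) (⟦v⟧≗f x))
  where
  ⟦scale⟧ : ∀ {m} (v : Vec ℤ m) x → ⟦ Vec.map (c *_) v ⟧ x ≡ c * ⟦ v ⟧ x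
  ⟦scale⟧ [] x = sym (ℤ.*-zeroʳ c)
  ⟦scale⟧ (a ∷ v) x = trans (cong (λ z → c * a + x * z) (⟦scale⟧ v x)) (distrib c a x (⟦ v ⟧ x))
    where
    distrib : ∀ c a x p → c * a + x * (c * p) ≡ c * (a + x * p)
    distrib = solve-∀

polynomial-raise : ∀ {d f} → Polynomial d f → Polynomial (suc d) f
polynomial-raise (v , ⟦v⟧≗f) = v Vec.∷ʳ + 0 , λ x → trans (⟦∷ʳ0⟧ v x) (⟦v⟧≗f x)
  where
  ⟦∷ʳ0⟧ : ∀ {m} (v : Vec ℤ m) x → ⟦ v Vec.∷ʳ + 0 ⟧ x ≡ ⟦ v ⟧ x
  ⟦∷ʳ0⟧ [] x = trans (cong (_+_ (+ 0)) (ℤ.*-zeroʳ x)) refl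
  ⟦∷ʳ0⟧ (a ∷ v) x = cong (λ z → a + x * z) (⟦∷ʳ0⟧ v x)

polynomial-≤ : ∀ {d D f} → d ≤ D → Polynomial d f → Polynomial D f
polynomial-≤ {d} {D} d≤D p with ℕ.m≤n⇒m<n∨m≡n d≤D
... | inj₂ refl = p
polynomial-≤ {d} {suc D} _ p | inj₁ d<1+D = polynomial-raise (polynomial-≤ (ℕ.≤-pred d<1+D) p)

polynomial-*-linear : ∀ {d f} c → Polynomial d f → Polynomial (suc d) (λ x → f x * (x - c))
polynomial-*-linear {f = f} c p@(v , ⟦v⟧≗f) with polynomial-+ (+ 0 ∷ v , λ x → cong (λ z → + 0 + x * z) (⟦v⟧≗f x))
                                                                (polynomial-raise (polynomial-scale (- c) p))
... | (w , ⟦w⟧≗) = w , λ x → trans (⟦w⟧≗ x) (expand x (f x) c)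
  where
  expand : ∀ x y c → + 0 + x * y + - c * y ≡ y * (x - c)
  expand = solve-∀

polynomial-sum : ∀ {D} m (g : ℕ → ℤ → ℤ) → (∀ t → t ≤ m → Polynomial D (g t)) → Polynomial D (λ x → sumℤ m (λ t → g t x))
polynomial-sum zero g poly = poly 0 z≤n
polynomial-sum (suc m) g poly =
  polynomial-+ (polynomial-sum m g (λ t t≤m → poly t (ℕ.m≤n⇒m≤1+n t≤m))) (poly (suc m) ℕ.≤-refl)

falling : ℤ → ℕ → ℤ
falling x zero = + 1
falling x (suc t) = falling x t * (x - + t)

polynomial-falling : ∀ t → Polynomial t (λ x → falling x t)
polynomial-falling zero = polynomial-const 0 (+ 1)
polynomial-falling (suc t) = polynomial-*-linear (+ t) (polynomial-falling t)

falling-0 : ∀ t → falling (+ 0) (suc t) ≡ + 0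
falling-0 zero = refl
falling-0 (suc t) = cong (_* (+ 0 - + suc t)) (falling-0 t)

falling-suc : ∀ x t → falling (x + + 1) (suc t) ≡ (x + + 1) * falling x t
falling-suc x zero = peel x
  where
  peel : ∀ x → + 1 * (x + + 1 - + 0) ≡ (x + + 1) * + 1
  peel = solve-∀
falling-suc x (suc t) = begin
  falling (x + + 1) (suc t) * (x + + 1 - + suc t)    ≡⟨ cong (_* (x + + 1 - + suc t)) (falling-suc x t) ⟩
  (x + + 1) * falling x t * (x + + 1 - + suc t)      ≡⟨ cong (λ z → (x + + 1) * falling x t * (x + + 1 - z)) (ℤ.pos-+ 1 t) ⟩
  (x + + 1) * falling x t * (x + + 1 - (+ 1 + + t))  ≡⟨ peel x (+ t) (falling x t) ⟩
  (x + + 1) * (falling x t * (x - + t))              ∎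
  where
  open ≡-Reasoning
  peel : ∀ x t F → (x + + 1) * F * (x + + 1 - (+ 1 + t)) ≡ (x + + 1) * (F * (x - t))
  peel = solve-∀

!*C≡falling : ∀ k t → + (t ! ℕ.* (k C t)) ≡ falling (+ k) t
!*C≡falling k zero = refl
!*C≡falling zero (suc t) = trans (cong +_ (ℕ.*-zeroʳ (suc t !))) (sym (falling-0 t))
!*C≡falling (suc k) (suc t) = begin
  + (suc t ! ℕ.* (suc k C suc t))
    ≡⟨ cong (λ z → + (suc t ! ℕ.* z)) (sym (nCk+nC[k+1]≡[n+1]C[k+1] k t)) ⟩
  + (suc t ! ℕ.* (k C t ℕ.+ k C suc t))
    ≡⟨ cong +_ (ℕ.*-distribˡ-+ (suc t !) (k C t) (k C suc t)) ⟩
  + (suc t ℕ.* t ! ℕ.* (k C t) ℕ.+ suc t ! ℕ.* (k C suc t))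
    ≡⟨ ℤ.pos-+ (suc t ℕ.* t ! ℕ.* (k C t)) (suc t ! ℕ.* (k C suc t)) ⟩
  + (suc t ℕ.* t ! ℕ.* (k C t)) + + (suc t ! ℕ.* (k C suc t))
    ≡⟨ cong₂ _+_ (trans (cong +_ (ℕ.*-assoc (suc t) (t !) (k C t))) (trans (ℤ.pos-* (suc t) _) (cong (+ suc t *_) (!*C≡falling k t))))
                 (!*C≡falling k (suc t)) ⟩
  + suc t * falling (+ k) t + falling (+ k) t * (+ k - + t)
    ≡⟨ cong (λ z → z * falling (+ k) t + falling (+ k) t * (+ k - + t)) (ℤ.pos-+ 1 t) ⟩
  (+ 1 + + t) * falling (+ k) t + falling (+ k) t * (+ k - + t)
    ≡⟨ collect (+ k) (+ t) (falling (+ k) t) ⟩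
  (+ k + + 1) * falling (+ k) t
    ≡⟨ falling-suc (+ k) t ⟨
  falling (+ k + + 1) (suc t)
    ≡⟨ cong (λ z → falling z (suc t)) (trans (sym (ℤ.pos-+ k 1)) (cong +_ (ℕ.+-comm k 1))) ⟩
  falling (+ suc k) (suc t) ∎
  where
  open ≡-Reasoning
  collect : ∀ k t F → (+ 1 + t) * F + F * (k - t) ≡ (k + + 1) * F
  collect = solve-∀

rising : ℕ → ℕ → ℕ
rising t zero = 1
rising t (suc e) = rising t e ℕ.* suc (t ℕ.+ e)

!*rising : ∀ t e → t ! ℕ.* rising t e ≡ (t ℕ.+ e) !
!*rising t zero = trans (ℕ.*-identityʳ (t !)) (cong _! (sym (ℕ.+-identityʳ t)))
!*rising t (suc e) = begin
  t ! ℕ.* (rising t e ℕ.* suc (t ℕ.+ e))   ≡⟨ ℕ.*-assoc (t !) (rising t e) _ ⟨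
  t ! ℕ.* rising t e ℕ.* suc (t ℕ.+ e)     ≡⟨ cong (ℕ._* suc (t ℕ.+ e)) (!*rising t e) ⟩
  (t ℕ.+ e) ! ℕ.* suc (t ℕ.+ e)            ≡⟨ ℕ.*-comm ((t ℕ.+ e) !) _ ⟩
  suc (t ℕ.+ e) !                          ≡⟨ cong _! (ℕ.+-suc t e) ⟨
  (t ℕ.+ suc e) !                          ∎
  where open ≡-Reasoning

toℚᵘ-/suc : ∀ z m → ℚ.toℚᵘ (z ℚ./ suc m) ℚᵘ.≃ ℚᵘ.mkℚᵘ z m
toℚᵘ-/suc z m = ℚ.toℚᵘ-fromℚᵘ (ℚᵘ.mkℚᵘ z m)

/suc-horner : ∀ a b k m → (a ℚ./ suc m) ℚ.+ ℕtoℚ k ℚ.* (b ℚ./ suc m) ≡ (a + + k * b) ℚ./ suc m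
/suc-horner a b k m = ℚ.toℚᵘ-injective (begin
  ℚ.toℚᵘ ((a ℚ./ suc m) ℚ.+ ℕtoℚ k ℚ.* (b ℚ./ suc m))
    ≈⟨ ℚ.toℚᵘ-homo-+ (a ℚ./ suc m) _ ⟩
  ℚ.toℚᵘ (a ℚ./ suc m) ℚᵘ.+ ℚ.toℚᵘ (ℕtoℚ k ℚ.* (b ℚ./ suc m))
    ≈⟨ ℚᵘ.+-cong (toℚᵘ-/suc a m) (ℚᵘ.≃-trans (ℚ.toℚᵘ-homo-* (ℕtoℚ k) (b ℚ./ suc m))
                                              (ℚᵘ.*-cong (toℚᵘ-/suc (+ k) 0) (toℚᵘ-/suc b m))) ⟩
  ℚᵘ.mkℚᵘ a m ℚᵘ.+ ℚᵘ.mkℚᵘ (+ k) 0 ℚᵘ.* ℚᵘ.mkℚᵘ b m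
    ≈⟨ ℚᵘ.*≡* cross ⟩
  ℚᵘ.mkℚᵘ (a + + k * b) m
    ≈⟨ toℚᵘ-/suc (a + + k * b) m ⟨
  ℚ.toℚᵘ ((a + + k * b) ℚ./ suc m) ∎)
  where
  open ℚᵘ.≃-Reasoning
  lhs = ℚᵘ.mkℚᵘ a m ℚᵘ.+ ℚᵘ.mkℚᵘ (+ k) 0 ℚᵘ.* ℚᵘ.mkℚᵘ b m
  cross : ℚᵘ.↥ lhs * ℚᵘ.↧ (ℚᵘ.mkℚᵘ (a + + k * b) m) ≡ ℚᵘ.↥ (ℚᵘ.mkℚᵘ (a + + k * b) m) * ℚᵘ.↧ lhs
  cross rewrite ℕ.+-identityʳ m = trans (expand a (+ k) b (+ suc m)) (cong ((a + + k * b) *_) (sym (ℤ.pos-* (suc m) (suc m))))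
    where
    expand : ∀ a k b S → (a * S + k * b * S) * S ≡ (a + k * b) * (S * S)
    expand = solve-∀

/suc-cancel : ∀ c m → (+ suc m * + c) ℚ./ suc m ≡ ℕtoℚ c
/suc-cancel c m = ℚ.toℚᵘ-injective (ℚᵘ.≃-trans (toℚᵘ-/suc (+ suc m * + c) m)
  (ℚᵘ.≃-trans (ℚᵘ.*≡* (comm (+ suc m) (+ c))) (ℚᵘ.≃-sym (toℚᵘ-/suc (+ c) 0))))
  where
  comm : ∀ S c → S * c * + 1 ≡ c * S
  comm = solve-∀

evalPoly-/suc : ∀ {d} (v : Vec ℤ d) k m → evalPoly (Vec.map (ℚ._/ suc m) v) (ℕtoℚ k) ≡ ⟦ v ⟧ (+ k) ℚ./ suc m
evalPoly-/suc [] k m =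
  ℚ.toℚᵘ-injective (ℚᵘ.≃-trans (toℚᵘ-/suc (+ 0) 0) (ℚᵘ.≃-trans (ℚᵘ.*≡* refl) (ℚᵘ.≃-sym (toℚᵘ-/suc (+ 0) m))))
evalPoly-/suc (a ∷ v) k m =
  trans (cong (λ z → (a ℚ./ suc m) ℚ.+ ℕtoℚ k ℚ.* z) (evalPoly-/suc v k m)) (/suc-horner a (⟦ v ⟧ (+ k)) k m)

sumℤ-cong≤ : ∀ m {g h : ℕ → ℤ} → (∀ i → i ≤ m → g i ≡ h i) → sumℤ m g ≡ sumℤ m h
sumℤ-cong≤ zero g≗h = g≗h 0 z≤n
sumℤ-cong≤ (suc m) g≗h = cong₂ _+_ (sumℤ-cong≤ m (λ i i≤m → g≗h i (ℕ.m≤n⇒m≤1+n i≤m))) (g≗h (suc m) ℕ.≤-refl)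

sumℤ-*ˡ : ∀ m c (g : ℕ → ℤ) → sumℤ m (λ i → c * g i) ≡ c * sumℤ m g
sumℤ-*ˡ zero c g = refl
sumℤ-*ˡ (suc m) c g = trans (cong (_+ c * g (suc m)) (sumℤ-*ˡ m c g)) (sym (ℤ.*-distribˡ-+ c _ _))

-- Clearing the denominator D! turns each k C t into an integer polynomial in k of degree t.
binomialSum-polynomial : ∀ D (a : ℕ → ℤ) (c : ℕ → ℕ) → (∀ k → + c k ≡ sumℤ D (λ t → + (k C t) * a t)) →
  Σ (Vec ℚ (suc D)) (λ P → ∀ k → ℕtoℚ (c k) ≡ evalPoly P (ℕtoℚ k))
binomialSum-polynomial D a c c≡sum = Vec.map (ℚ._/ suc M) v , λ k → sym (begin
  evalPoly (Vec.map (ℚ._/ suc M) v) (ℕtoℚ k)   ≡⟨ evalPoly-/suc v k M ⟩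
  ⟦ v ⟧ (+ k) ℚ./ suc M                          ≡⟨ cong (ℚ._/ suc M) (trans (⟦v⟧≗ (+ k)) (cleared k)) ⟩
  (+ suc M * + c k) ℚ./ suc M                    ≡⟨ /suc-cancel (c k) M ⟩
  ℕtoℚ (c k)                                     ∎)
  where
  open ≡-Reasoning
  M = ℕ.pred (D !)
  D!≡1+M : D ! ≡ suc M
  D!≡1+M = sym (ℕ.suc-pred (D !) {{D ℕ.!≢0}})
  term : ℕ → ℤ → ℤ
  term t x = a t * + rising t (D ∸ t) * falling x t
  poly : Polynomial D (λ x → sumℤ D (λ t → term t x))
  poly = polynomial-sum D term (λ t t≤D → polynomial-≤ t≤D (polynomial-scale (a t * + rising t (D ∸ t)) (polynomial-falling t)))
  v = proj₁ poly
  ⟦v⟧≗ = proj₂ poly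
  cleared : ∀ k → sumℤ D (λ t → term t (+ k)) ≡ + suc M * + c k
  cleared k = begin
    sumℤ D (λ t → term t (+ k))
      ≡⟨ sumℤ-cong≤ D (λ t t≤D → trans (cong (a t * + rising t (D ∸ t) *_) (sym (!*C≡falling k t))) (reorder t t≤D)) ⟩
    sumℤ D (λ t → + suc M * (+ (k C t) * a t))
      ≡⟨ sumℤ-*ˡ D (+ suc M) (λ t → + (k C t) * a t) ⟩
    + suc M * sumℤ D (λ t → + (k C t) * a t)
      ≡⟨ cong (+ suc M *_) (c≡sum k) ⟨
    + suc M * + c k ∎
    where
    D! : ∀ t → t ≤ D → t ! ℕ.* rising t (D ∸ t) ≡ suc M
    D! t t≤D = trans (!*rising t (D ∸ t)) (trans (cong _! (ℕ.m+[n∸m]≡n t≤D)) D!≡1+M)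
    reorder : ∀ t → t ≤ D → a t * + rising t (D ∸ t) * + (t ! ℕ.* (k C t)) ≡ + suc M * (+ (k C t) * a t)
    reorder t t≤D = begin
      a t * + rising t (D ∸ t) * + (t ! ℕ.* (k C t))
        ≡⟨ cong (a t * + rising t (D ∸ t) *_) (ℤ.pos-* (t !) (k C t)) ⟩
      a t * + rising t (D ∸ t) * (+ (t !) * + (k C t))
        ≡⟨ shuffle (a t) (+ rising t (D ∸ t)) (+ (t !)) (+ (k C t)) ⟩
      + (t !) * + rising t (D ∸ t) * (+ (k C t) * a t)
        ≡⟨ cong (_* (+ (k C t) * a t)) (trans (sym (ℤ.pos-* (t !) _)) (cong +_ (D! t t≤D))) ⟩
      + suc M * (+ (k C t) * a t) ∎
      where
      shuffle : ∀ a r f b → a * r * (f * b) ≡ f * r * (b * a)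
      shuffle = solve-∀

proposition1 : Σ (ℕ → ℕ → ℕ) (λ c →
    ((k : ℕ) → 1 ≤ k →
      (c 0 k ≡ 1)
      × ((i : ℕ) → k < i → c i k ≡ 0)
      × ((n : ℕ) → 1 ≤ n → + f n k ≡ altPoly k (λ i → c i k) (+ (3 ℕ.^ n))))
    ×
    ((i : ℕ) → Σ (Vec ℚ (suc (3 ℕ.* i))) (λ P →
      (k : ℕ) → 1 ≤ k → ℕtoℚ (c i k) ≡ evalPoly P (ℕtoℚ k))))
proposition1 = c , (λ k _ → leading k , vanishing k , counting k) , polynomialInK
  where
  c : ℕ → ℕ → ℕ
  c i k = coeff k (arrangement k) i
  leading : ∀ k → c 0 k ≡ 1
  leading k = coeff-leading k (arrangement k) (arrangement-nonzero k)
  vanishing : ∀ k i → k < i → c i k ≡ 0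
  vanishing k = coeff-vanish k (arrangement k)
  counting : ∀ k n → 1 ≤ n → + f n k ≡ altPoly k (λ i → c i k) (+ (3 ℕ.^ n))
  counting k n _ = trans (cong +_ (f≡count-avoids n k)) (count-avoids k (arrangement k))
  polynomialInK : ∀ i → Σ (Vec ℚ (suc (3 ℕ.* i))) (λ P → ∀ k → 1 ≤ k → ℕtoℚ (c i k) ≡ evalPoly P (ℕtoℚ k))
  polynomialInK i = proj₁ poly , λ k _ → proj₂ poly k
    where
    poly = binomialSum-polynomial (3 ℕ.* i) (λ t → forwardDiff i t 0) (c i) (coeff-newton i)
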